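{- Let $1\le k\le n-1$ be integers and let $D_{k,n}(t)\in\mathbb{Q}[t]$ be the Ehrhart polynomial of the matroid polytope of the minimal matroid $T_{k,n}$. Then \[D_{k,n}(t) = \sum_{j=0}^{k-1} \binom{k-1}{j}\binom{n-k-1}{j}\binom{t+n-1-j}{n-1}.\]
   Context: For integers $1\le k\le n-1$, $T_{k,n}$ denotes the cycle matroid of the graph obtained from a cycle of length $k+1$ by replacing one of its edges with $n-k$ parallel edges. For a matroid $M$ on $\{1,\dots,n\}$, its matroid polytope is $\mathscr{P}(M)=\operatorname{conv}\{\sum_{i\in B}e_i : B \text{ a basis of } M\}\subseteq\mathbb{R}^n$, and its Ehrhart polynomial is the polynomial $i(t)$ with $i(t)=\#(t\mathscr{P}(M)\cap\mathbb{Z}^n)$ for all integers $t\ge0$. -}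

module Defs where

open import Data.Nat as ℕ using (ℕ; zero; suc; _<_; _<?_; _∸_; s≤s)
open import Data.Nat.Properties using (m<n⇒m<1+n)
open import Data.Nat.Combinatorics using (_C_)
open import Data.Integer as ℤ using (ℤ; +_)
open import Data.Rational as ℚ using (ℚ; 0ℚ; 1ℚ; _/_)
open import Data.Fin as Fin using (Fin; toℕ; fromℕ; fromℕ<)
open import Data.Fin.Subset as Sub using (Subset; ∣_∣)
open import Data.Vec using (Vec; lookup)
open import Data.List using (List; []; _∷_; length; map; upTo)
open import Data.Nat.ListAction using (sum)
open import Data.List.Relation.Unary.All using (All)
open import Data.List.Relation.Unary.Unique.Propositional using (Unique)
open import Data.List.Membership.Propositional using (_∈_)
open import Data.Product using (Σ; ∃; _×_; _,_; proj₁; proj₂)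
open import Data.Sum using (_⊎_)
open import Data.Bool using (Bool; true; false)
open import Relation.Nullary using (yes; no)
open import Relation.Binary.PropositionalEquality using (_≡_)
open import Function.Bundles using (_⇔_)

record Multigraph (v m : ℕ) : Set where
  field
    ends : Fin m → Fin v × Fin v

open Multigraph public

data AdjIn {v m : ℕ} (G : Multigraph v m) (S : Subset m) (a b : Fin v) : Set where
  adj : (e : Fin m) → e Sub.∈ S →
        (ends G e ≡ (a , b)) ⊎ (ends G e ≡ (b , a)) → AdjIn G S a b

data Reach {v m : ℕ} (G : Multigraph v m) (S : Subset m) : Fin v → Fin v → Set where
  here : ∀ {a} → Reach G S a a
  step : ∀ {a b c} → AdjIn G S a b → Reach G S b c → Reach G S a c

Connected : {v m : ℕ} → Multigraph v m → Subset m → Set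
Connected G S = ∀ a b → Reach G S a b

SpanningTree : {v m : ℕ} → Multigraph v m → Subset m → Set
SpanningTree {v} G S = Connected G S × (∣ S ∣ ≡ v ∸ 1)

-- Bases of the cycle matroid of a CONNECTED multigraph = its spanning trees.
CycleMatroidBasis : {v m : ℕ} → Multigraph v m → Subset m → Set
CycleMatroidBasis = SpanningTree

-- The graph defining T_{k,n}: vertices 0..k arranged in a cycle of length
-- k+1; edge i (for i < k) joins vertex i and vertex i+1; the remaining
-- edge k—0 of the cycle is replaced by the n-k parallel edges k, ..., n-1.

TGraph : (k n : ℕ) → Multigraph (suc k) n
TGraph k n = record { ends = e-ends }
  where
  e-ends : Fin n → Fin (suc k) × Fin (suc k)
  e-ends e with toℕ e <? k
  ... | yes p = fromℕ< (m<n⇒m<1+n p) , fromℕ< (s≤s p)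
  ... | no _  = fromℕ k , Fin.zero

TBasis : (k n : ℕ) → Subset n → Set
TBasis k n = CycleMatroidBasis (TGraph k n)

indicator : {n : ℕ} → Subset n → Fin n → ℚ
indicator B i with lookup B i
... | true  = 1ℚ
... | false = 0ℚ

combo : {n : ℕ} → List (Subset n × ℚ) → Fin n → ℚ
combo []             i = 0ℚ
combo ((B , c) ∷ cs) i = c ℚ.* indicator B i ℚ.+ combo cs i

weightSum : {n : ℕ} → List (Subset n × ℚ) → ℚ
weightSum []             = 0ℚ
weightSum ((_ , c) ∷ cs) = c ℚ.+ weightSum cs

InMatroidPolytope : {n : ℕ} → (Subset n → Set) → (Fin n → ℚ) → Set
InMatroidPolytope {n} IsBasis z =
  Σ (List (Subset n × ℚ)) λ L →
    All (λ p → IsBasis (proj₁ p)) L ×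
    All (λ p → 0ℚ ℚ.≤ proj₂ p) L ×
    weightSum L ≡ 1ℚ ×
    (∀ i → z i ≡ combo L i)

InDilateLattice : {n : ℕ} → (Subset n → Set) → ℕ → Vec ℤ n → Set
InDilateLattice {n} IsBasis t x =
  Σ (Fin n → ℚ) λ z → InMatroidPolytope IsBasis z ×
    (∀ i → (lookup x i / 1) ≡ ((+ t) / 1) ℚ.* z i)

HasCardinality : {n : ℕ} → (Vec ℤ n → Set) → ℕ → Set
HasCardinality {n} P N =
  Σ (List (Vec ℤ n)) λ L → Unique L × (∀ x → (x ∈ L) ⇔ P x) × length L ≡ N

EhrhartValue : {n : ℕ} → (Subset n → Set) → ℕ → ℕ → Set
EhrhartValue IsBasis t N = HasCardinality (InDilateLattice IsBasis t) N

Dformula : (k n t : ℕ) → ℕ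
Dformula k n t =
  sum (map (λ j → ((k ∸ 1) C j) ℕ.* ((n ∸ k ∸ 1) C j) ℕ.* ((t ℕ.+ n ∸ 1 ∸ j) C (n ∸ 1)))
           (upTo k))

-- T_{k,n} is the cycle matroid of the path 0 — 1 — ⋯ — k (the k series edges) closed up by m = n − k
-- parallel edges between k and 0.  A spanning tree contains either all series edges, or all but one of them
-- together with one parallel edge.  Hence the lattice points of t·P(T_{k,n}) are exactly the vectors (y, w)
-- in ℕᵏ × ℕᵐ with every yᵢ ≤ t, Σ w ≤ t and Σ y + Σ w = k t: these constraints hold for every basis, and
-- conversely such a point is a sum of t bases, pairing each unit of a deficit t − yᵢ with a unit of some wⱼ.
-- Grouped by s = Σ w, the vector t − y is a composition of s into k parts and w one into m parts, so there are
-- Σ_{s ≤ t} C(s+a, a) C(s+b, b) of them, where a = k − 1 and b = m − 1.  Both C(s+a, a) C(s+b, b) and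
-- Σⱼ C(a, j) C(b, j) C(s+a+b−j, a+b) satisfy the same four-term Pascal recurrence in (a, b, s) with the same
-- boundary values, and summing the latter over s ≤ t by the hockey-stick identity gives the formula.

module Submission where

open import Defs
open import Data.Nat using (ℕ; zero; suc; z≤n; s≤s; _+_; _*_; _∸_; _≤_; _<_; _<?_)
import Data.Nat.Properties as ℕP
open import Data.Nat.Combinatorics using (_C_; nCn≡1; k>n⇒nCk≡0; nCk+nC[k+1]≡[n+1]C[k+1])
open import Data.Nat.Solver using (module +-*-Solver)
open import Data.Fin.Base as Fin using (Fin; toℕ; fromℕ; _↑ˡ_; _↑ʳ_)
import Data.Fin.Properties as FinP
open import Data.Vec.Base as Vec using (Vec; []; _∷_; lookup)
import Data.Vec.Properties as VecP
import Data.Vec.Relation.Unary.All as Allᵛ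
import Data.Vec.Relation.Unary.All.Properties as AllᵛP
open import Data.List.Base as List using (List; []; _∷_; _++_; length; applyUpTo; upTo; cartesianProductWith)
import Data.List.Properties as ListP
open import Data.List.Membership.Propositional using (_∈_)
open import Data.List.Membership.Propositional.Properties
  using (∈-map⁺; ∈-map⁻; ∈-++⁺ˡ; ∈-++⁺ʳ; ∈-++⁻; ∈-cartesianProductWith⁺; ∈-cartesianProductWith⁻)
open import Data.List.Relation.Unary.Any using (here)
open import Data.List.Relation.Unary.Unique.Propositional using (Unique)
import Data.List.Relation.Unary.Unique.Propositional.Properties as UniqueP
import Data.List.Relation.Unary.All as Allˡ
import Data.List.Relation.Unary.All.Properties as AllˡP
open import Data.List.Relation.Unary.AllPairs using ([]; _∷_)
open import Data.List.Relation.Binary.Disjoint.Propositional using (Disjoint)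
open import Data.Integer.Base as ℤ using (ℤ)
import Data.Integer.Properties as ℤP
open import Data.Rational.Base as ℚ using (ℚ; mkℚ; 0ℚ; 1ℚ; _/_)
import Data.Rational.Properties as ℚP
import Data.Nat.Coprimality as Coprime
open import Algebra.Bundles using (Monoid; CommutativeRing)
open import Data.Fin.Subset as Subset using (Subset; ∣_∣)
import Data.Fin.Subset.Properties as SubsetP
open import Data.Bool.Base using (Bool; true; false; not)
open import Data.Product.Base using (Σ; ∃; _×_; _,_; proj₁; proj₂)
open import Data.Sum.Base using (_⊎_; inj₁; inj₂)
open import Relation.Nullary using (¬_; Dec; yes; no; does)
open import Data.Empty using (⊥; ⊥-elim)
open import Data.Nat.ListAction using () renaming (sum to sumˡ)
open import Function.Base using (_∘_)
open import Function.Bundles using (mk⇔)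
open import Relation.Binary.PropositionalEquality

import Algebra.Properties.Monoid.Sum as MonoidSum
import Algebra.Properties.Semiring.Sum as SemiringSum
open SemiringSum ℕP.+-*-semiring
  using (sum; sum-syntax; sum-cong-≗; ∑-distrib-+; *-distribˡ-sum; ∑-comm; sum-init-last; sum-replicate-zero)

open +-*-Solver using (solve; _:=_; con; _:+_; _:*_)
open ≡-Reasoning

-- Binomial sums

∑< : ℕ → (ℕ → ℕ) → ℕ
∑< m f = ∑[ i < m ] f (toℕ i)

∑<-cong : ∀ m {f g : ℕ → ℕ} → (∀ j → j < m → f j ≡ g j) → ∑< m f ≡ ∑< m g
∑<-cong m f≈g = sum-cong-≗ (λ i → f≈g (toℕ i) (FinP.toℕ<n i))

∑<-distrib-+ : ∀ m (f g : ℕ → ℕ) → ∑< m (λ j → f j + g j) ≡ ∑< m f + ∑< m g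
∑<-distrib-+ m f g = ∑-distrib-+ {m} (f ∘ toℕ) (g ∘ toℕ)

∑<-distribˡ-* : ∀ m c (f : ℕ → ℕ) → ∑< m (λ j → c * f j) ≡ c * ∑< m f
∑<-distribˡ-* m c f = sym (*-distribˡ-sum {m} c (f ∘ toℕ))

∑<-comm : ∀ m p (f : ℕ → ℕ → ℕ) → ∑< m (λ i → ∑< p (f i)) ≡ ∑< p (λ j → ∑< m (λ i → f i j))
∑<-comm m p f = ∑-comm {m} {p} (λ i j → f (toℕ i) (toℕ j))

∑<-suc : ∀ m (f : ℕ → ℕ) → ∑< (suc m) f ≡ ∑< m f + f m
∑<-suc m f = trans (sum-init-last {m} (f ∘ toℕ))
  (cong₂ _+_ (sum-cong-≗ {m} (cong f ∘ FinP.toℕ-inject₁)) (cong f (FinP.toℕ-fromℕ m)))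

∑<-zero : ∀ m (f : ℕ → ℕ) → (∀ j → j < m → f j ≡ 0) → ∑< m f ≡ 0
∑<-zero m f f≈0 = trans (∑<-cong m f≈0) (sum-replicate-zero m)

∑<-extend : ∀ m (f : ℕ → ℕ) → f m ≡ 0 → ∑< (suc m) f ≡ ∑< m f
∑<-extend m f fm≡0 = trans (∑<-suc m f) (trans (cong (∑< m f +_) fm≡0) (ℕP.+-identityʳ _))

sum-map-applyUpTo : ∀ m (f g : ℕ → ℕ) → sumˡ (List.map f (applyUpTo g m)) ≡ ∑< m (f ∘ g)
sum-map-applyUpTo zero    f g = refl
sum-map-applyUpTo (suc m) f g = cong (f (g 0) +_) (sum-map-applyUpTo m f (g ∘ suc))

sum-map-upTo : ∀ m (f : ℕ → ℕ) → sumˡ (List.map f (upTo m)) ≡ ∑< m f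
sum-map-upTo m f = sum-map-applyUpTo m f (λ j → j)

pascal : ∀ n k → suc n C suc k ≡ n C k + n C suc k
pascal n k = sym (nCk+nC[k+1]≡[n+1]C[k+1] n k)

nC[1+n]≡0 : ∀ n → n C suc n ≡ 0
nC[1+n]≡0 n = k>n⇒nCk≡0 (ℕP.n<1+n n)

_C⁻_ : ℕ → ℕ → ℕ
n C⁻ zero  = 0
n C⁻ suc j = n C j

[1+n]Cj≡nCj+nC⁻j : ∀ n j → suc n C j ≡ n C j + n C⁻ j
[1+n]Cj≡nCj+nC⁻j n zero    = refl
[1+n]Cj≡nCj+nC⁻j n (suc j) = trans (pascal n j) (ℕP.+-comm (n C j) _)

hockeyStick : ∀ t c d → c ≤ d → ∑< (suc t) (λ s → (s + c) C d) ≡ (suc t + c) C suc d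
hockeyStick zero c d c≤d = begin
  c C d + 0           ≡⟨ cong (c C d +_) (sym (k>n⇒nCk≡0 (s≤s c≤d))) ⟩
  c C d + c C suc d   ≡⟨ sym (pascal c d) ⟩
  suc c C suc d       ∎
hockeyStick (suc t) c d c≤d = begin
  ∑< (suc (suc t)) (λ s → (s + c) C d)          ≡⟨ ∑<-suc (suc t) (λ s → (s + c) C d) ⟩
  ∑< (suc t) (λ s → (s + c) C d) + n C d         ≡⟨ cong (_+ n C d) (hockeyStick t c d c≤d) ⟩
  n C suc d + n C d                              ≡⟨ ℕP.+-comm (n C suc d) _ ⟩
  n C d + n C suc d                              ≡⟨ sym (pascal n d) ⟩
  suc n C suc d                                  ∎
  where n = suc t + c

Recurrence : (ℕ → ℕ → ℕ → ℕ) → Set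
Recurrence F = ∀ a b t →
  F (suc a) (suc b) (suc t) + F a b (suc t) ≡
  F a (suc b) (suc t) + F (suc a) b (suc t) + F (suc a) (suc b) t

recurrence-unique : ∀ {F G : ℕ → ℕ → ℕ → ℕ} → Recurrence F → Recurrence G →
                    (∀ a b → F a b 0 ≡ G a b 0) → (∀ b t → F 0 b t ≡ G 0 b t) →
                    (∀ a t → F a 0 t ≡ G a 0 t) → ∀ t a b → F a b t ≡ G a b t
recurrence-unique {F} {G} recF recG t₀ a₀ b₀ = go
  where
  go : ∀ t a b → F a b t ≡ G a b t
  go zero    a       b       = t₀ a b
  go (suc t) zero    b       = a₀ b (suc t)
  go (suc t) (suc a) zero    = b₀ (suc a) (suc t)
  go (suc t) (suc a) (suc b) = ℕP.+-cancelʳ-≡ _ _ _ (begin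
    F (suc a) (suc b) (suc t) + F a b (suc t)
      ≡⟨ recF a b t ⟩
    F a (suc b) (suc t) + F (suc a) b (suc t) + F (suc a) (suc b) t
      ≡⟨ cong₂ _+_ (cong₂ _+_ (go (suc t) a (suc b)) (go (suc t) (suc a) b)) (go t (suc a) (suc b)) ⟩
    G a (suc b) (suc t) + G (suc a) b (suc t) + G (suc a) (suc b) t
      ≡⟨ sym (recG a b t) ⟩
    G (suc a) (suc b) (suc t) + G a b (suc t)
      ≡⟨ cong (G (suc a) (suc b) (suc t) +_) (sym (go (suc t) a b)) ⟩
    G (suc a) (suc b) (suc t) + F a b (suc t) ∎)

binomialProduct : ℕ → ℕ → ℕ → ℕ
binomialProduct a b t = ((t + a) C a) * ((t + b) C b)

convolutionTerm : ℕ → ℕ → ℕ → ℕ → ℕ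
convolutionTerm a b t j = (a C j) * (b C j) * ((t + (a + b) ∸ j) C (a + b))

binomialConvolution : ℕ → ℕ → ℕ → ℕ
binomialConvolution a b t = ∑< (suc a) (convolutionTerm a b t)

binomialProduct-recurrence : Recurrence binomialProduct
binomialProduct-recurrence a b t = begin
  binomialProduct (suc a) (suc b) (suc t) + binomialProduct a b (suc t)
    ≡⟨ cong (_+ u * v) (cong₂ _*_ (pascal′ a) (pascal′ b)) ⟩
  (u + u′) * (v + v′) + u * v
    ≡⟨ solve 4 (λ u u′ v v′ → (u :+ u′) :* (v :+ v′) :+ u :* v
                            := u :* (v :+ v′) :+ (u :+ u′) :* v :+ u′ :* v′) refl u u′ v v′ ⟩
  u * (v + v′) + (u + u′) * v + u′ * v′
    ≡⟨ cong₂ (λ x y → u * x + y * v + u′ * v′) (sym (pascal′ b)) (sym (pascal′ a)) ⟩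
  binomialProduct a (suc b) (suc t) + binomialProduct (suc a) b (suc t) + binomialProduct (suc a) (suc b) t ∎
  where
  pascal′ : ∀ c → (suc t + suc c) C suc c ≡ (suc t + c) C c + (t + suc c) C suc c
  pascal′ c = trans (pascal (t + suc c) c) (cong (λ x → x C c + (t + suc c) C suc c) (ℕP.+-suc t c))
  u  = (suc t + a) C a
  u′ = (t + suc a) C suc a
  v  = (suc t + b) C b
  v′ = (t + suc b) C suc b

module ConvolutionRecurrence (a b t : ℕ) where
  d e M : ℕ
  d = a + b
  e = t + d
  M = suc (suc a)

  A A⁻ B B⁻ Y Z W : ℕ → ℕ
  A  j = a C j
  A⁻ j = a C⁻ j
  B  j = b C j
  B⁻ j = b C⁻ j
  Y  j = (suc (suc e) ∸ j) C suc d
  Z  j = (suc e ∸ j) C d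
  W  j = (suc (suc e) ∸ j) C suc (suc d)

  j≤a⇒j≤e : ∀ {j} → j ≤ a → j ≤ e
  j≤a⇒j≤e j≤a = ℕP.≤-trans j≤a (ℕP.≤-trans (ℕP.m≤m+n a b) (ℕP.m≤n+m d t))

  sucsuc-top : ∀ j → j < M → suc (suc (suc e)) ∸ j ≡ suc (suc (suc e) ∸ j)
  sucsuc-top j (s≤s j≤1+a) = ℕP.+-∸-assoc 1 (ℕP.≤-trans j≤1+a (s≤s (ℕP.m≤n⇒m≤1+n (j≤a⇒j≤e ℕP.≤-refl))))

  suc-top : ∀ j → j < suc a → suc (suc e) ∸ j ≡ suc (suc e ∸ j)
  suc-top j (s≤s j≤a) = ℕP.+-∸-assoc 1 (ℕP.m≤n⇒m≤1+n (j≤a⇒j≤e j≤a))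

  term₁₁-normalised : ∀ j → convolutionTerm (suc a) (suc b) (suc t) j ≡
                 (suc a C j) * (suc b C j) * ((suc (suc (suc e)) ∸ j) C suc (suc d))
  term₁₁-normalised j = cong₂ (λ x y → (suc a C j) * (suc b C j) * ((x ∸ j) C y))
    (solve 3 (λ t a b → (con 1 :+ t) :+ ((con 1 :+ a) :+ (con 1 :+ b)) := con 3 :+ (t :+ (a :+ b))) refl t a b)
    (solve 2 (λ a b → (con 1 :+ a) :+ (con 1 :+ b) := con 2 :+ (a :+ b)) refl a b)

  pascalₜ : ∑< M (convolutionTerm (suc a) (suc b) (suc t)) ≡
            ∑< M (λ j → (suc a C j) * (suc b C j) * W j) + ∑< M (λ j → (suc a C j) * (suc b C j) * Y j)
  pascalₜ = trans (∑<-cong M λ j j<M → begin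
      convolutionTerm (suc a) (suc b) (suc t) j
        ≡⟨ term₁₁-normalised j ⟩
      c j * ((suc (suc (suc e)) ∸ j) C suc (suc d))
        ≡⟨ cong (λ x → c j * (x C suc (suc d))) (sucsuc-top j j<M) ⟩
      c j * (suc (suc (suc e) ∸ j) C suc (suc d))
        ≡⟨ cong (c j *_) (trans (pascal (suc (suc e) ∸ j) (suc d)) (ℕP.+-comm (Y j) (W j))) ⟩
      c j * (W j + Y j)
        ≡⟨ ℕP.*-distribˡ-+ (c j) (W j) (Y j) ⟩
      c j * W j + c j * Y j ∎)
    (∑<-distrib-+ M (λ j → c j * W j) (λ j → c j * Y j))
    where c = λ j → (suc a C j) * (suc b C j)

  previous-t : ∑< M (convolutionTerm (suc a) (suc b) t) ≡ ∑< M (λ j → (suc a C j) * (suc b C j) * W j)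
  previous-t = ∑<-cong M λ j _ → cong₂ (λ x y → (suc a C j) * (suc b C j) * ((x ∸ j) C y))
    (solve 3 (λ t a b → t :+ ((con 1 :+ a) :+ (con 1 :+ b)) := con 2 :+ (t :+ (a :+ b))) refl t a b)
    (solve 2 (λ a b → (con 1 :+ a) :+ (con 1 :+ b) := con 2 :+ (a :+ b)) refl a b)

  pascalₐᵦ : ∑< M (λ j → (suc a C j) * (suc b C j) * Y j) ≡
             ∑< M (λ j → A j * (suc b C j) * Y j) + ∑< M (λ j → A⁻ j * B j * Y j) + ∑< M (λ j → A⁻ j * B⁻ j * Y j)
  pascalₐᵦ = trans (∑<-cong M λ j _ → begin
      (suc a C j) * (suc b C j) * Y j
        ≡⟨ cong₂ (λ x y → x * y * Y j) ([1+n]Cj≡nCj+nC⁻j a j) ([1+n]Cj≡nCj+nC⁻j b j) ⟩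
      (A j + A⁻ j) * (B j + B⁻ j) * Y j
        ≡⟨ solve 5 (λ p p′ q q′ y → (p :+ p′) :* (q :+ q′) :* y
                                 := p :* (q :+ q′) :* y :+ p′ :* q :* y :+ p′ :* q′ :* y) refl (A j) (A⁻ j) (B j) (B⁻ j) (Y j) ⟩
      A j * (B j + B⁻ j) * Y j + A⁻ j * B j * Y j + A⁻ j * B⁻ j * Y j
        ≡⟨ cong (λ x → A j * x * Y j + A⁻ j * B j * Y j + A⁻ j * B⁻ j * Y j) (sym ([1+n]Cj≡nCj+nC⁻j b j)) ⟩
      A j * (suc b C j) * Y j + A⁻ j * B j * Y j + A⁻ j * B⁻ j * Y j ∎)
    (trans (∑<-distrib-+ M (λ j → A j * (suc b C j) * Y j + A⁻ j * B j * Y j) (λ j → A⁻ j * B⁻ j * Y j))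
           (cong (_+ ∑< M (λ j → A⁻ j * B⁻ j * Y j)) (∑<-distrib-+ M (λ j → A j * (suc b C j) * Y j) (λ j → A⁻ j * B j * Y j))))

  conv₁₀ : binomialConvolution (suc a) b (suc t) ≡ ∑< M (λ j → A j * B j * Y j) + ∑< M (λ j → A⁻ j * B j * Y j)
  conv₁₀ = trans (∑<-cong M λ j _ → begin
      convolutionTerm (suc a) b (suc t) j
        ≡⟨ cong (λ x → (suc a C j) * B j * ((x ∸ j) C suc d))
             (solve 3 (λ t a b → (con 1 :+ t) :+ ((con 1 :+ a) :+ b) := con 2 :+ (t :+ (a :+ b))) refl t a b) ⟩
      (suc a C j) * B j * Y j
        ≡⟨ cong (λ x → x * B j * Y j) ([1+n]Cj≡nCj+nC⁻j a j) ⟩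
      (A j + A⁻ j) * B j * Y j
        ≡⟨ solve 4 (λ p p′ q y → (p :+ p′) :* q :* y := p :* q :* y :+ p′ :* q :* y) refl (A j) (A⁻ j) (B j) (Y j) ⟩
      A j * B j * Y j + A⁻ j * B j * Y j ∎)
    (∑<-distrib-+ M (λ j → A j * B j * Y j) (λ j → A⁻ j * B j * Y j))

  conv₀₁ : binomialConvolution a (suc b) (suc t) ≡ ∑< M (λ j → A j * (suc b C j) * Y j)
  conv₀₁ = sym (trans (∑<-extend (suc a) (λ j → A j * (suc b C j) * Y j) (cong (λ x → x * (suc b C suc a) * Y (suc a)) (nC[1+n]≡0 a)))
    (∑<-cong (suc a) λ j _ → cong₂ (λ x y → A j * (suc b C j) * ((x ∸ j) C y))
      (sym (solve 3 (λ t a b → (con 1 :+ t) :+ (a :+ (con 1 :+ b)) := con 2 :+ (t :+ (a :+ b))) refl t a b))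
      (sym (ℕP.+-suc a b))))

  ∑ABY-extend : ∑< M (λ j → A j * B j * Y j) ≡ ∑< (suc a) (λ j → A j * B j * Y j)
  ∑ABY-extend = ∑<-extend (suc a) (λ j → A j * B j * Y j) (cong (λ x → x * B (suc a) * Y (suc a)) (nC[1+n]≡0 a))

  -- Pascal's rule Y (j + 1) + Z j = Y j absorbs the shifted sum into the one for (a, b, t + 1).
  ∑ABY-shift : ∑< (suc a) (λ j → A j * B j * Y (suc j)) + binomialConvolution a b (suc t) ≡ ∑< (suc a) (λ j → A j * B j * Y j)
  ∑ABY-shift = trans (sym (∑<-distrib-+ (suc a) (λ j → A j * B j * Y (suc j)) (λ j → A j * B j * Z j)))
    (∑<-cong (suc a) λ j j<1+a → begin
      A j * B j * Y (suc j) + A j * B j * Z j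
        ≡⟨ sym (ℕP.*-distribˡ-+ (A j * B j) (Y (suc j)) (Z j)) ⟩
      A j * B j * ((suc e ∸ j) C suc d + (suc e ∸ j) C d)
        ≡⟨ cong (A j * B j *_) (trans (ℕP.+-comm ((suc e ∸ j) C suc d) _) (sym (pascal (suc e ∸ j) d))) ⟩
      A j * B j * (suc (suc e ∸ j) C suc d)
        ≡⟨ cong (λ x → A j * B j * (x C suc d)) (sym (suc-top j j<1+a)) ⟩
      A j * B j * Y j ∎)

  recurrence : binomialConvolution (suc a) (suc b) (suc t) + binomialConvolution a b (suc t) ≡
               binomialConvolution a (suc b) (suc t) + binomialConvolution (suc a) b (suc t) + binomialConvolution (suc a) (suc b) t
  recurrence = begin
    binomialConvolution (suc a) (suc b) (suc t) + z
      ≡⟨ cong (_+ z) (trans pascalₜ (cong (w +_) pascalₐᵦ)) ⟩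
    w + (p + q + r) + z
      ≡⟨ solve 5 (λ w p q r z → w :+ (p :+ q :+ r) :+ z := p :+ ((r :+ z) :+ q) :+ w) refl w p q r z ⟩
    p + ((r + z) + q) + w
      ≡⟨ cong (λ x → p + (x + q) + w) ∑ABY-shift ⟩
    p + (y + q) + w
      ≡⟨ cong₂ (λ x x′ → x + x′ + w) (sym conv₀₁) (sym (trans conv₁₀ (cong (_+ q) ∑ABY-extend))) ⟩
    binomialConvolution a (suc b) (suc t) + binomialConvolution (suc a) b (suc t) + w
      ≡⟨ cong (binomialConvolution a (suc b) (suc t) + binomialConvolution (suc a) b (suc t) +_) (sym previous-t) ⟩
    binomialConvolution a (suc b) (suc t) + binomialConvolution (suc a) b (suc t) + binomialConvolution (suc a) (suc b) t ∎
    where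
    w = ∑< M (λ j → (suc a C j) * (suc b C j) * W j)
    p = ∑< M (λ j → A j * (suc b C j) * Y j)
    q = ∑< M (λ j → A⁻ j * B j * Y j)
    r = ∑< (suc a) (λ j → A j * B j * Y (suc j))
    z = binomialConvolution a b (suc t)
    y = ∑< (suc a) (λ j → A j * B j * Y j)

binomialProduct≡binomialConvolution : ∀ t a b → binomialProduct a b t ≡ binomialConvolution a b t
binomialProduct≡binomialConvolution =
  recurrence-unique binomialProduct-recurrence ConvolutionRecurrence.recurrence at-t₀ at-a₀ at-b₀
  where
  at-t₀ : ∀ a b → binomialProduct a b 0 ≡ binomialConvolution a b 0
  at-t₀ a b = begin
    (a C a) * (b C b)          ≡⟨ cong₂ _*_ (nCn≡1 a) (nCn≡1 b) ⟩
    1                          ≡⟨ sym (nCn≡1 (a + b)) ⟩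
    (a + b) C (a + b)          ≡⟨ sym (ℕP.+-identityʳ _) ⟩
    (a + b) C (a + b) + 0      ≡⟨ cong₂ _+_ (sym (ℕP.*-identityˡ _)) (sym (higher a)) ⟩
    binomialConvolution a b 0  ∎
    where
    higher : ∀ a → ∑< a (λ j → convolutionTerm a b 0 (suc j)) ≡ 0
    higher zero    = refl
    higher (suc a) = ∑<-zero (suc a) _ (λ j _ → trans
      (cong ((suc a C suc j) * (b C suc j) *_) (k>n⇒nCk≡0 (s≤s (ℕP.m∸n≤m (a + b) j))))
      (ℕP.*-zeroʳ ((suc a C suc j) * (b C suc j))))
  at-a₀ : ∀ b t → binomialProduct 0 b t ≡ binomialConvolution 0 b t
  at-a₀ b t = trans (ℕP.*-identityˡ _) (sym (trans (ℕP.+-identityʳ _) (ℕP.*-identityˡ _)))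
  at-b₀ : ∀ a t → binomialProduct a 0 t ≡ binomialConvolution a 0 t
  at-b₀ a t = sym (begin
    1 * 1 * c + ∑< a (λ j → (a C suc j) * 0 * ((t + (a + 0) ∸ suc j) C (a + 0)))
      ≡⟨ cong₂ _+_ (ℕP.*-identityˡ c) (∑<-zero a _ (λ j _ → cong (_* ((t + (a + 0) ∸ suc j) C (a + 0))) (ℕP.*-zeroʳ (a C suc j)))) ⟩
    c + 0                      ≡⟨ ℕP.+-identityʳ c ⟩
    c                          ≡⟨ cong (λ x → (t + x) C x) (ℕP.+-identityʳ a) ⟩
    (t + a) C a                ≡⟨ sym (ℕP.*-identityʳ _) ⟩
    binomialProduct a 0 t      ∎)
    where c = (t + (a + 0)) C (a + 0)

∑<-binomialProduct : ∀ a b t → ∑< (suc t) (binomialProduct a b) ≡ Dformula (suc a) (suc a + suc b) t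
∑<-binomialProduct a b t = begin
  ∑< (suc t) (binomialProduct a b)
    ≡⟨ ∑<-cong (suc t) (λ s _ → binomialProduct≡binomialConvolution s a b) ⟩
  ∑< (suc t) (λ s → ∑< (suc a) (convolutionTerm a b s))
    ≡⟨ ∑<-comm (suc t) (suc a) (λ s j → convolutionTerm a b s j) ⟩
  ∑< (suc a) (λ j → ∑< (suc t) (λ s → convolutionTerm a b s j))
    ≡⟨ ∑<-cong (suc a) summed-over-t ⟩
  ∑< (suc a) (λ j → (a C j) * (b C j) * ((suc (t + (a + b)) ∸ j) C suc (a + b)))
    ≡⟨ sym (trans (sum-map-upTo (suc a) _) (∑<-cong (suc a) λ j _ →
         cong₂ (λ x y → (a C j) * (x C j) * y) b-eq (cong₂ (λ x y → (x ∸ j) C y) top-eq bottom-eq))) ⟩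
  Dformula (suc a) (suc a + suc b) t ∎
  where
  b-eq : suc a + suc b ∸ suc a ∸ 1 ≡ b
  b-eq = cong (_∸ 1) (ℕP.m+n∸m≡n a (suc b))
  top-eq : t + (suc a + suc b) ∸ 1 ≡ suc (t + (a + b))
  top-eq = cong (_∸ 1) (solve 3 (λ t a b → t :+ ((con 1 :+ a) :+ (con 1 :+ b)) := con 2 :+ (t :+ (a :+ b))) refl t a b)
  bottom-eq : suc a + suc b ∸ 1 ≡ suc (a + b)
  bottom-eq = ℕP.+-suc a b
  summed-over-t : ∀ j → j < suc a →
    ∑< (suc t) (λ s → convolutionTerm a b s j) ≡ (a C j) * (b C j) * ((suc (t + (a + b)) ∸ j) C suc (a + b))
  summed-over-t j (s≤s j≤a) = begin
    ∑< (suc t) (λ s → convolutionTerm a b s j)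
      ≡⟨ ∑<-distribˡ-* (suc t) ((a C j) * (b C j)) (λ s → (s + (a + b) ∸ j) C (a + b)) ⟩
    (a C j) * (b C j) * ∑< (suc t) (λ s → (s + (a + b) ∸ j) C (a + b))
      ≡⟨ cong ((a C j) * (b C j) *_) (∑<-cong (suc t) (λ s _ → cong (_C (a + b)) (ℕP.+-∸-assoc s j≤a+b))) ⟩
    (a C j) * (b C j) * ∑< (suc t) (λ s → (s + (a + b ∸ j)) C (a + b))
      ≡⟨ cong ((a C j) * (b C j) *_) (hockeyStick t (a + b ∸ j) (a + b) (ℕP.m∸n≤m (a + b) j)) ⟩
    (a C j) * (b C j) * ((suc t + (a + b ∸ j)) C suc (a + b))
      ≡⟨ cong (λ x → (a C j) * (b C j) * (x C suc (a + b))) (sym (ℕP.+-∸-assoc (suc t) j≤a+b)) ⟩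
    (a C j) * (b C j) * ((suc (t + (a + b)) ∸ j) C suc (a + b)) ∎
    where j≤a+b = ℕP.≤-trans j≤a (ℕP.m≤m+n a b)

-- Counting feasible points

incrementHead : ∀ {m} → Vec ℕ (suc m) → Vec ℕ (suc m)
incrementHead (x ∷ xs) = suc x ∷ xs

compositions : (m s : ℕ) → List (Vec ℕ m)
compositions zero    zero    = [] ∷ []
compositions zero    (suc s) = []
compositions (suc m) zero    = List.map (0 ∷_) (compositions m zero)
compositions (suc m) (suc s) = List.map (0 ∷_) (compositions m (suc s)) ++ List.map incrementHead (compositions (suc m) s)

length-compositions : ∀ m s → length (compositions (suc m) s) ≡ (s + m) C m
length-compositions zero    zero    = refl
length-compositions zero    (suc s) = trans (ListP.length-map incrementHead (compositions 1 s)) (length-compositions zero s)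
length-compositions (suc m) zero    =
  trans (ListP.length-map (0 ∷_) (compositions (suc m) zero))
        (trans (length-compositions m zero) (trans (nCn≡1 m) (sym (nCn≡1 (suc m)))))
length-compositions (suc m) (suc s) = begin
  length (List.map (0 ∷_) (compositions (suc m) (suc s)) ++ List.map incrementHead (compositions (suc (suc m)) s))
    ≡⟨ ListP.length-++ (List.map (0 ∷_) (compositions (suc m) (suc s))) ⟩
  length (List.map (0 ∷_) (compositions (suc m) (suc s))) + length (List.map incrementHead (compositions (suc (suc m)) s))
    ≡⟨ cong₂ _+_ (ListP.length-map (0 ∷_) (compositions (suc m) (suc s))) (ListP.length-map incrementHead (compositions (suc (suc m)) s)) ⟩
  length (compositions (suc m) (suc s)) + length (compositions (suc (suc m)) s)
    ≡⟨ cong₂ _+_ (length-compositions m (suc s)) (length-compositions (suc m) s) ⟩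
  (suc s + m) C m + (s + suc m) C suc m
    ≡⟨ cong (λ x → x C m + (s + suc m) C suc m) (sym (ℕP.+-suc s m)) ⟩
  (s + suc m) C m + (s + suc m) C suc m
    ≡⟨ sym (pascal (s + suc m) m) ⟩
  (suc s + suc m) C suc m ∎

∈-compositions⁺ : ∀ m s (xs : Vec ℕ m) → Vec.sum xs ≡ s → xs ∈ compositions m s
∈-compositions⁺ zero    zero    []           _  = here refl
∈-compositions⁺ (suc m) zero    (zero ∷ xs)  eq = ∈-map⁺ (0 ∷_) (∈-compositions⁺ m zero xs eq)
∈-compositions⁺ (suc m) (suc s) (zero ∷ xs)  eq = ∈-++⁺ˡ (∈-map⁺ (0 ∷_) (∈-compositions⁺ m (suc s) xs eq))
∈-compositions⁺ (suc m) (suc s) (suc x ∷ xs) eq =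
  ∈-++⁺ʳ (List.map (0 ∷_) (compositions m (suc s)))
         (∈-map⁺ incrementHead (∈-compositions⁺ (suc m) s (x ∷ xs) (ℕP.suc-injective eq)))

∈-compositions⁻ : ∀ m s (xs : Vec ℕ m) → xs ∈ compositions m s → Vec.sum xs ≡ s
∈-compositions⁻ zero    zero    [] _ = refl
∈-compositions⁻ (suc m) zero    xs p with ∈-map⁻ (0 ∷_) p
... | ys , ys∈ , refl = ∈-compositions⁻ m zero ys ys∈
∈-compositions⁻ (suc m) (suc s) xs p with ∈-++⁻ (List.map (0 ∷_) (compositions m (suc s))) p
... | inj₁ p′ with ∈-map⁻ (0 ∷_) p′
...   | ys , ys∈ , refl = ∈-compositions⁻ m (suc s) ys ys∈
∈-compositions⁻ (suc m) (suc s) xs p | inj₂ p′ with ∈-map⁻ incrementHead p′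
...   | y ∷ ys , ys∈ , refl = cong suc (∈-compositions⁻ (suc m) s (y ∷ ys) ys∈)

compositions-unique : ∀ m s → Unique (compositions m s)
compositions-unique zero    zero    = Allˡ.[] ∷ []
compositions-unique zero    (suc s) = []
compositions-unique (suc m) zero    = UniqueP.map⁺ VecP.∷-injectiveʳ (compositions-unique m zero)
compositions-unique (suc m) (suc s) =
  UniqueP.++⁺ (UniqueP.map⁺ VecP.∷-injectiveʳ (compositions-unique m (suc s)))
              (UniqueP.map⁺ incrementHead-injective (compositions-unique (suc m) s))
              head-zero-or-not
  where
  incrementHead-injective : ∀ {xs ys : Vec ℕ (suc m)} → incrementHead xs ≡ incrementHead ys → xs ≡ ys
  incrementHead-injective {_ ∷ _} {_ ∷ _} refl = refl
  head-zero-or-not : Disjoint (List.map (0 ∷_) (compositions m (suc s))) (List.map incrementHead (compositions (suc m) s))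
  head-zero-or-not (p , q) with ∈-map⁻ (0 ∷_) p | ∈-map⁻ incrementHead q
  ... | _ , _ , refl | _ ∷ _ , _ , ()

length-cartesianProductWith : ∀ {A B D : Set} (f : A → B → D) xs ys →
                              length (cartesianProductWith f xs ys) ≡ length xs * length ys
length-cartesianProductWith f []       ys = refl
length-cartesianProductWith f (x ∷ xs) ys =
  trans (ListP.length-++ (List.map (f x) ys)) (cong₂ _+_ (ListP.length-map (f x) ys) (length-cartesianProductWith f xs ys))

entries≤sum : ∀ {n} (xs : Vec ℕ n) → Allᵛ.All (_≤ Vec.sum xs) xs
entries≤sum []       = Allᵛ.[]
entries≤sum (x ∷ xs) = ℕP.m≤m+n x (Vec.sum xs) Allᵛ.∷ Allᵛ.map (λ p → ℕP.≤-trans p (ℕP.m≤n+m (Vec.sum xs) x)) (entries≤sum xs)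

map-+-injective : ∀ {n} {xs ys : Vec ℕ n} → Vec.map ℤ.+_ xs ≡ Vec.map ℤ.+_ ys → xs ≡ ys
map-+-injective {xs = []}     {[]}     _  = refl
map-+-injective {xs = x ∷ xs} {y ∷ ys} eq =
  cong₂ _∷_ (ℤP.+-injective (VecP.∷-injectiveˡ eq)) (map-+-injective (VecP.∷-injectiveʳ eq))

-- The first k coordinates of a point are the series edges, the last m the parallel ones.
module FeasiblePoints (k m t : ℕ) where

  point : Vec ℕ k → Vec ℕ m → Vec ℤ (k + m)
  point ys w = Vec.map ℤ.+_ ys Vec.++ Vec.map ℤ.+_ w

  Feasible : Vec ℤ (k + m) → Set
  Feasible x = Σ (Vec ℕ k) λ ys → Σ (Vec ℕ m) λ w →
    x ≡ point ys w × Allᵛ.All (_≤ t) ys × Vec.sum w ≤ t × Vec.sum ys + Vec.sum w ≡ k * t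

  lookup-point-series : ∀ ys w (i : Fin k) → lookup (point ys w) (i ↑ˡ m) ≡ ℤ.+ lookup ys i
  lookup-point-series ys w i = trans (VecP.lookup-++ˡ (Vec.map ℤ.+_ ys) (Vec.map ℤ.+_ w) i) (VecP.lookup-map i ℤ.+_ ys)

  lookup-point-parallel : ∀ ys w (j : Fin m) → lookup (point ys w) (k ↑ʳ j) ≡ ℤ.+ lookup w j
  lookup-point-parallel ys w j = trans (VecP.lookup-++ʳ (Vec.map ℤ.+_ ys) (Vec.map ℤ.+_ w) j) (VecP.lookup-map j ℤ.+_ w)

  point-injective : ∀ {ys ys′ w w′} → point ys w ≡ point ys′ w′ → ys ≡ ys′ × w ≡ w′
  point-injective {ys} {ys′} eq with VecP.++-injective (Vec.map ℤ.+_ ys) (Vec.map ℤ.+_ ys′) eq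
  ... | eq₁ , eq₂ = map-+-injective eq₁ , map-+-injective eq₂

  complement : ∀ {n} → Vec ℕ n → Vec ℕ n
  complement = Vec.map (t ∸_)

  sum-complement : ∀ {n} (xs : Vec ℕ n) → Allᵛ.All (_≤ t) xs → Vec.sum (complement xs) + Vec.sum xs ≡ n * t
  sum-complement []       Allᵛ.[] = refl
  sum-complement {suc n} (x ∷ xs) (x≤t Allᵛ.∷ xs≤t) = begin
    t ∸ x + Vec.sum (complement xs) + (x + Vec.sum xs)
      ≡⟨ solve 4 (λ a b c d → a :+ b :+ (c :+ d) := (a :+ c) :+ (b :+ d)) refl (t ∸ x) (Vec.sum (complement xs)) x (Vec.sum xs) ⟩
    (t ∸ x + x) + (Vec.sum (complement xs) + Vec.sum xs)
      ≡⟨ cong₂ _+_ (ℕP.m∸n+n≡m x≤t) (sum-complement xs xs≤t) ⟩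
    t + n * t ∎

  complement-involutive : ∀ {n} (xs : Vec ℕ n) → Allᵛ.All (_≤ t) xs → complement (complement xs) ≡ xs
  complement-involutive []       Allᵛ.[] = refl
  complement-involutive (x ∷ xs) (x≤t Allᵛ.∷ xs≤t) = cong₂ _∷_ (ℕP.m∸[m∸n]≡n x≤t) (complement-involutive xs xs≤t)

  complement≤t : ∀ {n} (xs : Vec ℕ n) → Allᵛ.All (_≤ t) (complement xs)
  complement≤t []       = Allᵛ.[]
  complement≤t (x ∷ xs) = ℕP.m∸n≤m t x Allᵛ.∷ complement≤t xs

  entries≤t : ∀ {n s} (xs : Vec ℕ n) → Vec.sum xs ≡ s → s ≤ t → Allᵛ.All (_≤ t) xs
  entries≤t xs refl s≤t = Allᵛ.map (λ p → ℕP.≤-trans p s≤t) (entries≤sum xs)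

  layer : ℕ → List (Vec ℤ (k + m))
  layer s = cartesianProductWith point (List.map complement (compositions k s)) (compositions m s)

  ∈-layer⁻ : ∀ s x → x ∈ layer s → s ≤ t → Σ (Vec ℕ k) λ ys → Σ (Vec ℕ m) λ w → Feasible x × x ≡ point ys w × Vec.sum w ≡ s
  ∈-layer⁻ s x p s≤t with ∈-cartesianProductWith⁻ point (List.map complement (compositions k s)) (compositions m s) p
  ... | ys , w , ys∈ , w∈ , refl with ∈-map⁻ complement ys∈
  ... | zs , zs∈ , refl = complement zs , w , feasible , refl , sum-w
    where
    sum-w = ∈-compositions⁻ m s w w∈
    sum-zs = ∈-compositions⁻ k s zs zs∈
    feasible : Feasible (point (complement zs) w)
    feasible = complement zs , w , refl , complement≤t zs , subst (_≤ t) (sym sum-w) s≤t ,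
      trans (cong (Vec.sum (complement zs) +_) (trans sum-w (sym sum-zs))) (sum-complement zs (entries≤t zs sum-zs s≤t))

  ∈-layer⁺ : ∀ ys w → Allᵛ.All (_≤ t) ys → Vec.sum ys + Vec.sum w ≡ k * t → point ys w ∈ layer (Vec.sum w)
  ∈-layer⁺ ys w ys≤t eq = ∈-cartesianProductWith⁺ point ys∈ (∈-compositions⁺ m (Vec.sum w) w refl)
    where
    sum-complement-ys : Vec.sum (complement ys) ≡ Vec.sum w
    sum-complement-ys = ℕP.+-cancelʳ-≡ (Vec.sum ys) _ _
      (trans (sum-complement ys ys≤t) (trans (sym eq) (ℕP.+-comm (Vec.sum ys) (Vec.sum w))))
    ys∈ : ys ∈ List.map complement (compositions k (Vec.sum w))
    ys∈ = subst (_∈ List.map complement (compositions k (Vec.sum w))) (complement-involutive ys ys≤t)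
                (∈-map⁺ complement (∈-compositions⁺ k (Vec.sum w) (complement ys) sum-complement-ys))

  layer-unique : ∀ s → s ≤ t → Unique (layer s)
  layer-unique s s≤t = UniqueP.cartesianProductWith⁺ point point-injective complements-unique (compositions-unique m s)
    where
    involutive-on-layer : List.map complement (List.map complement (compositions k s)) ≡ compositions k s
    involutive-on-layer = trans (sym (ListP.map-∘ (compositions k s))) (ListP.map-id-local (Allˡ.tabulate
      (λ {zs} zs∈ → complement-involutive zs (entries≤t zs (∈-compositions⁻ k s zs zs∈) s≤t))))
    complements-unique : Unique (List.map complement (compositions k s))
    complements-unique = UniqueP.map⁻ (subst Unique (sym involutive-on-layer) (compositions-unique k s))

  layersBelow : ℕ → List (Vec ℤ (k + m))
  layersBelow zero    = []
  layersBelow (suc s) = layersBelow s ++ layer s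

  ∈-layersBelow⁻ : ∀ s x → x ∈ layersBelow s → ∃ λ s′ → s′ < s × x ∈ layer s′
  ∈-layersBelow⁻ (suc s) x p with ∈-++⁻ (layersBelow s) p
  ... | inj₂ q = s , ℕP.≤-refl , q
  ... | inj₁ q with ∈-layersBelow⁻ s x q
  ...   | s′ , s′<s , q′ = s′ , ℕP.m<n⇒m<1+n s′<s , q′

  ∈-layersBelow⁺ : ∀ s s′ x → s′ < s → x ∈ layer s′ → x ∈ layersBelow s
  ∈-layersBelow⁺ (suc s) s′ x s′<1+s p with s′ ℕP.≟ s
  ... | yes refl = ∈-++⁺ʳ (layersBelow s) p
  ... | no s′≢s  = ∈-++⁺ˡ (∈-layersBelow⁺ s s′ x (ℕP.≤∧≢⇒< (ℕP.≤-pred s′<1+s) s′≢s) p)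

  layersBelow-unique : ∀ s → s ≤ suc t → Unique (layersBelow s)
  layersBelow-unique zero    _         = []
  layersBelow-unique (suc s) (s≤s s≤t) = UniqueP.++⁺ (layersBelow-unique s (ℕP.m≤n⇒m≤1+n s≤t)) (layer-unique s s≤t) disjoint
    where
    disjoint : Disjoint (layersBelow s) (layer s)
    disjoint {x} (p , q) with ∈-layersBelow⁻ s x p
    ... | s′ , s′<s , q′ with ∈-layer⁻ s′ x q′ (ℕP.≤-trans (ℕP.<⇒≤ s′<s) s≤t) | ∈-layer⁻ s x q s≤t
    ... | ys , w , _ , eq , sum≡s′ | ys′ , w′ , _ , eq′ , sum≡s =
      ℕP.<-irrefl (trans (sym sum≡s′) (trans (cong Vec.sum (proj₂ (point-injective {ys} {ys′} {w} {w′} (trans (sym eq) eq′)))) sum≡s)) s′<s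

  length-layersBelow : ∀ s → length (layersBelow s) ≡ ∑< s (λ s′ → length (compositions k s′) * length (compositions m s′))
  length-layersBelow zero    = refl
  length-layersBelow (suc s) = begin
    length (layersBelow s ++ layer s)
      ≡⟨ ListP.length-++ (layersBelow s) ⟩
    length (layersBelow s) + length (layer s)
      ≡⟨ cong₂ _+_ (length-layersBelow s)
           (trans (length-cartesianProductWith point (List.map complement (compositions k s)) (compositions m s))
                  (cong (_* length (compositions m s)) (ListP.length-map complement (compositions k s)))) ⟩
    ∑< s c + c s
      ≡⟨ sym (∑<-suc s c) ⟩
    ∑< (suc s) c ∎
    where c = λ s′ → length (compositions k s′) * length (compositions m s′)

  enumeration : List (Vec ℤ (k + m))
  enumeration = layersBelow (suc t)

  ∈-enumeration⁻ : ∀ x → x ∈ enumeration → Feasible x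
  ∈-enumeration⁻ x p with ∈-layersBelow⁻ (suc t) x p
  ... | s′ , s′<1+t , q = proj₁ (proj₂ (proj₂ (∈-layer⁻ s′ x q (ℕP.≤-pred s′<1+t))))

  ∈-enumeration⁺ : ∀ x → Feasible x → x ∈ enumeration
  ∈-enumeration⁺ x (ys , w , refl , ys≤t , w≤t , eq) = ∈-layersBelow⁺ (suc t) (Vec.sum w) _ (s≤s w≤t) (∈-layer⁺ ys w ys≤t eq)

  enumeration-unique : Unique enumeration
  enumeration-unique = layersBelow-unique (suc t) ℕP.≤-refl

length-enumeration : ∀ a b t → length (FeasiblePoints.enumeration (suc a) (suc b) t) ≡ ∑< (suc t) (binomialProduct a b)
length-enumeration a b t = trans (FeasiblePoints.length-layersBelow (suc a) (suc b) t (suc t))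
  (∑<-cong (suc t) (λ s _ → cong₂ _*_ (length-compositions a s) (length-compositions b s)))

-- Rational arithmetic

ι : ℤ → ℚ
ι i = i / 1

ι≡mkℚ : ∀ i → ι i ≡ mkℚ i 0 (Coprime.sym (Coprime.1-coprimeTo ℤ.∣ i ∣))
ι≡mkℚ i = ℚP.↥p/↧p≡p (mkℚ i 0 (Coprime.sym (Coprime.1-coprimeTo ℤ.∣ i ∣)))

ι-homo-+ : ∀ i j → ι (i ℤ.+ j) ≡ ι i ℚ.+ ι j
ι-homo-+ i j rewrite ι≡mkℚ i | ι≡mkℚ j = sym (cong (_/ 1) (cong₂ ℤ._+_ (ℤP.*-identityʳ i) (ℤP.*-identityʳ j)))

ι-homo-* : ∀ i j → ι (i ℤ.* j) ≡ ι i ℚ.* ι j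
ι-homo-* i j rewrite ι≡mkℚ i | ι≡mkℚ j = refl

ι-mono-≤ : ∀ {i j} → i ℤ.≤ j → ι i ℚ.≤ ι j
ι-mono-≤ {i} {j} i≤j rewrite ι≡mkℚ i | ι≡mkℚ j =
  ℚ.*≤* (subst₂ ℤ._≤_ (sym (ℤP.*-identityʳ i)) (sym (ℤP.*-identityʳ j)) i≤j)

ι-cancel-≤ : ∀ {i j} → ι i ℚ.≤ ι j → i ℤ.≤ j
ι-cancel-≤ {i} {j} ιi≤ιj rewrite ι≡mkℚ i | ι≡mkℚ j with ιi≤ιj
... | ℚ.*≤* i≤j = subst₂ ℤ._≤_ (ℤP.*-identityʳ i) (ℤP.*-identityʳ j) i≤j

ι-injective : ∀ {i j} → ι i ≡ ι j → i ≡ j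
ι-injective eq = ℤP.≤-antisym (ι-cancel-≤ (ℚP.≤-reflexive eq)) (ι-cancel-≤ (ℚP.≤-reflexive (sym eq)))

ιℕ : ℕ → ℚ
ιℕ n = ι (ℤ.+ n)

ιℕ-homo-+ : ∀ m n → ιℕ (m + n) ≡ ιℕ m ℚ.+ ιℕ n
ιℕ-homo-+ m n = trans (cong ι (ℤP.pos-+ m n)) (ι-homo-+ (ℤ.+ m) (ℤ.+ n))

ιℕ-homo-* : ∀ m n → ιℕ (m * n) ≡ ιℕ m ℚ.* ιℕ n
ιℕ-homo-* m n = trans (cong ι (ℤP.pos-* m n)) (ι-homo-* (ℤ.+ m) (ℤ.+ n))

ιℕ-mono-≤ : ∀ {m n} → m ≤ n → ιℕ m ℚ.≤ ιℕ n
ιℕ-mono-≤ m≤n = ι-mono-≤ (ℤ.+≤+ m≤n)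

ιℕ-cancel-≤ : ∀ {m n} → ιℕ m ℚ.≤ ιℕ n → m ≤ n
ιℕ-cancel-≤ {m} {n} ιm≤ιn with ι-cancel-≤ {ℤ.+ m} {ℤ.+ n} ιm≤ιn
... | ℤ.+≤+ m≤n = m≤n

ιℕ-injective : ∀ {m n} → ιℕ m ≡ ιℕ n → m ≡ n
ιℕ-injective eq = ℤP.+-injective (ι-injective eq)

ιℕ-nonNeg : ∀ n → 0ℚ ℚ.≤ ιℕ n
ιℕ-nonNeg n = ιℕ-mono-≤ {0} {n} z≤n

ιℕ-*-monoʳ-≤ : ∀ n {p q} → p ℚ.≤ q → ιℕ n ℚ.* p ℚ.≤ ιℕ n ℚ.* q
ιℕ-*-monoʳ-≤ n = ℚP.*-monoˡ-≤-nonNeg (ιℕ n) {{ℚ.nonNegative (ιℕ-nonNeg n)}}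

1/suc : ℕ → ℚ
1/suc n = mkℚ (ℤ.+ 1) n (Coprime.1-coprimeTo (suc n))

ιℕ-*-1/suc : ∀ n → ιℕ (suc n) ℚ.* 1/suc n ≡ 1ℚ
ιℕ-*-1/suc n rewrite ι≡mkℚ (ℤ.+ suc n) = ℚP.*-inverseʳ (mkℚ (ℤ.+ suc n) 0 (Coprime.sym (Coprime.1-coprimeTo (suc n))))

1/suc-nonNeg : ∀ n → 0ℚ ℚ.≤ 1/suc n
1/suc-nonNeg n = ℚP.nonNegative⁻¹ (1/suc n)

module ∑ℚ = SemiringSum (CommutativeRing.semiring ℚP.+-*-commutativeRing)

module _ {c ℓ} (M : Monoid c ℓ) where
  open Monoid M using (Carrier; _≈_; _∙_; ∙-congˡ; identityˡ; assoc) renaming (sym to ≈-sym; trans to ≈-trans)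
  open MonoidSum M using () renaming (sum to sumᴹ)

  sum-↑ : ∀ k {m} (f : Fin (k + m) → Carrier) → sumᴹ f ≈ sumᴹ (λ i → f (i ↑ˡ m)) ∙ sumᴹ (λ j → f (k ↑ʳ j))
  sum-↑ zero    f = ≈-sym (identityˡ _)
  sum-↑ (suc k) f = ≈-trans (∙-congˡ (sum-↑ k (f ∘ Fin.suc))) (≈-sym (assoc _ _ _))

ιℕ-sum : ∀ {n} (f : Fin n → ℕ) → ιℕ (sum f) ≡ ∑ℚ.sum (ιℕ ∘ f)
ιℕ-sum {zero}  f = refl
ιℕ-sum {suc n} f = trans (ιℕ-homo-+ (f Fin.zero) _) (cong (ιℕ (f Fin.zero) ℚ.+_) (ιℕ-sum (f ∘ Fin.suc)))

boolToℕ : Bool → ℕ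
boolToℕ true  = 1
boolToℕ false = 0

count : ∀ {n} → (Fin n → Bool) → ℕ
count f = sum (boolToℕ ∘ f)

∣p∣≡count : ∀ {n} (p : Subset n) → ∣ p ∣ ≡ count (lookup p)
∣p∣≡count []          = refl
∣p∣≡count (true ∷ p)  = cong suc (∣p∣≡count p)
∣p∣≡count (false ∷ p) = ∣p∣≡count p

indicator≡ιℕ : ∀ {n} (B : Subset n) i → indicator B i ≡ ιℕ (boolToℕ (lookup B i))
indicator≡ιℕ B i with lookup B i
... | true  = refl
... | false = refl

-- Connectivity of the graph of T_{k,n}

module _ {v m : ℕ} {G : Multigraph v m} {S : Subset m} where

  AdjIn-sym : ∀ {a b} → AdjIn G S a b → AdjIn G S b a
  AdjIn-sym (adj e e∈S (inj₁ eq)) = adj e e∈S (inj₂ eq)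
  AdjIn-sym (adj e e∈S (inj₂ eq)) = adj e e∈S (inj₁ eq)

  Reach-trans : ∀ {a b c} → Reach G S a b → Reach G S b c → Reach G S a c
  Reach-trans here         q = q
  Reach-trans (step a~b p) q = step a~b (Reach-trans p q)

  Reach-sym : ∀ {a b} → Reach G S a b → Reach G S b a
  Reach-sym here         = here
  Reach-sym (step a~b p) = Reach-trans (Reach-sym p) (step (AdjIn-sym a~b) here)

  connected-via : ∀ c → (∀ a → Reach G S a c) → Connected G S
  connected-via c reach a b = Reach-trans (reach a) (Reach-sym (reach b))

module _ {k n : ℕ} where

  ends-series : ∀ (e : Fin n) → toℕ e < k →
                toℕ (proj₁ (ends (TGraph k n) e)) ≡ toℕ e × toℕ (proj₂ (ends (TGraph k n) e)) ≡ suc (toℕ e)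
  ends-series e e<k with toℕ e <? k
  ... | yes e<k′ = FinP.toℕ-fromℕ< (ℕP.m<n⇒m<1+n e<k′) , FinP.toℕ-fromℕ< (s≤s e<k′)
  ... | no  e≮k  = ⊥-elim (e≮k e<k)

  ends-parallel : ∀ (e : Fin n) → ¬ toℕ e < k → ends (TGraph k n) e ≡ (fromℕ k , Fin.zero)
  ends-parallel e e≮k with toℕ e <? k
  ... | yes e<k = ⊥-elim (e≮k e<k)
  ... | no  _   = refl

data EdgeView (k m : ℕ) : Fin (k + m) → Set where
  series   : (i : Fin k) → EdgeView k m (i ↑ˡ m)
  parallel : (j : Fin m) → EdgeView k m (k ↑ʳ j)

edgeView : ∀ k m (e : Fin (k + m)) → EdgeView k m e
edgeView zero    m e           = parallel e
edgeView (suc k) m Fin.zero    = series Fin.zero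
edgeView (suc k) m (Fin.suc e) with edgeView k m e
... | series i   = series (Fin.suc i)
... | parallel j = parallel j

module TGraphConnectivity (k m : ℕ) (S : Subset (k + m)) where
  G : Multigraph (suc k) (k + m)
  G = TGraph k (k + m)

  series<k : ∀ (i : Fin k) → toℕ (i ↑ˡ m) < k
  series<k i = subst (_< k) (sym (FinP.toℕ-↑ˡ i m)) (FinP.toℕ<n i)

  parallel≮k : ∀ (j : Fin m) → ¬ toℕ (k ↑ʳ j) < k
  parallel≮k j k+j<k = ℕP.<-irrefl refl (ℕP.≤-trans k+j<k (subst (k ≤_) (sym (FinP.toℕ-↑ʳ k j)) (ℕP.m≤m+n k (toℕ j))))

  ends-series↑ : ∀ (i : Fin k) →
                 toℕ (proj₁ (ends G (i ↑ˡ m))) ≡ toℕ i × toℕ (proj₂ (ends G (i ↑ˡ m))) ≡ suc (toℕ i)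
  ends-series↑ i with ends-series {k} {k + m} (i ↑ˡ m) (series<k i)
  ... | eq₁ , eq₂ = trans eq₁ (FinP.toℕ-↑ˡ i m) , trans eq₂ (cong suc (FinP.toℕ-↑ˡ i m))

  ends-parallel↑ : ∀ (j : Fin m) → ends G (k ↑ʳ j) ≡ (fromℕ k , Fin.zero)
  ends-parallel↑ j = ends-parallel {k} {k + m} (k ↑ʳ j) (parallel≮k j)

  adjacent-series : ∀ (i : Fin k) → lookup S (i ↑ˡ m) ≡ true →
                    ∀ a b → toℕ a ≡ toℕ i → toℕ b ≡ suc (toℕ i) → AdjIn G S a b
  adjacent-series i i∈S a b a≡i b≡1+i with ends-series↑ i
  ... | eq₁ , eq₂ = adj (i ↑ˡ m) (VecP.lookup⇒[]= (i ↑ˡ m) S i∈S)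
    (inj₁ (cong₂ _,_ (FinP.toℕ-injective (trans eq₁ (sym a≡i))) (FinP.toℕ-injective (trans eq₂ (sym b≡1+i)))))

  adjacent-parallel : ∀ (j : Fin m) → lookup S (k ↑ʳ j) ≡ true → AdjIn G S (fromℕ k) Fin.zero
  adjacent-parallel j j∈S = adj (k ↑ʳ j) (VecP.lookup⇒[]= (k ↑ʳ j) S j∈S) (inj₁ (ends-parallel↑ j))

  reach-down : ∀ r (r<1+k : r < suc k) → (∀ (i : Fin k) → toℕ i < r → lookup S (i ↑ˡ m) ≡ true) →
               Reach G S (Fin.fromℕ< r<1+k) Fin.zero
  reach-down zero    _           _     = here
  reach-down (suc r) (s≤s r<k) below =
    step (AdjIn-sym (adjacent-series i (below i (s≤s (ℕP.≤-reflexive i≡r))) _ _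
                      (trans (FinP.toℕ-fromℕ< (ℕP.m<n⇒m<1+n r<k)) (sym i≡r))
                      (trans (FinP.toℕ-fromℕ< (s≤s r<k)) (cong suc (sym i≡r)))))
         (reach-down r (ℕP.m<n⇒m<1+n r<k) (λ i′ i′<r → below i′ (ℕP.m<n⇒m<1+n i′<r)))
    where
    i = Fin.fromℕ< r<k
    i≡r = FinP.toℕ-fromℕ< r<k

  reach-up : ∀ d r (r<1+k : r < suc k) → r + d ≡ k → (∀ (i : Fin k) → r ≤ toℕ i → lookup S (i ↑ˡ m) ≡ true) →
             Reach G S (Fin.fromℕ< r<1+k) (fromℕ k)
  reach-up zero r r<1+k r+0≡k _ = subst (Reach G S (Fin.fromℕ< r<1+k))
    (FinP.toℕ-injective (trans (FinP.toℕ-fromℕ< r<1+k)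
      (trans (sym (ℕP.+-identityʳ r)) (trans r+0≡k (sym (FinP.toℕ-fromℕ k)))))) here
  reach-up (suc d) r r<1+k r+1+d≡k above =
    step (adjacent-series i (above i (ℕP.≤-reflexive (sym i≡r))) _ _
           (trans (FinP.toℕ-fromℕ< r<1+k) (sym i≡r)) (trans (FinP.toℕ-fromℕ< (s≤s r<k)) (cong suc (sym i≡r))))
         (reach-up d (suc r) (s≤s r<k) (trans (sym (ℕP.+-suc r d)) r+1+d≡k) (λ i′ r<i′ → above i′ (ℕP.<⇒≤ r<i′)))
    where
    r<k : r < k
    r<k = subst (r <_) r+1+d≡k (ℕP.m<m+n r (s≤s z≤n))
    i = Fin.fromℕ< r<k
    i≡r = FinP.toℕ-fromℕ< r<k

  reach-zero : ∀ {a} → Reach G S (Fin.fromℕ< (FinP.toℕ<n a)) Fin.zero → Reach G S a Fin.zero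
  reach-zero {a} = subst (λ u → Reach G S u Fin.zero) (FinP.fromℕ<-toℕ a (FinP.toℕ<n a))

  series-connected : (∀ i → lookup S (i ↑ˡ m) ≡ true) → Connected G S
  series-connected all∈S = connected-via Fin.zero λ a →
    reach-zero (reach-down (toℕ a) (FinP.toℕ<n a) (λ i _ → all∈S i))

  -- Vertices up to the missing series edge i reach 0 directly, those beyond it go round through k and the parallel edge j.
  exchange-connected : (i : Fin k) (j : Fin m) → (∀ i′ → toℕ i′ ≢ toℕ i → lookup S (i′ ↑ˡ m) ≡ true) →
                       lookup S (k ↑ʳ j) ≡ true → Connected G S
  exchange-connected i j others∈S j∈S = connected-via Fin.zero λ a → reach-zero (go a (toℕ a ℕP.≤? toℕ i))
    where
    go : ∀ a → Dec (toℕ a ≤ toℕ i) → Reach G S (Fin.fromℕ< (FinP.toℕ<n a)) Fin.zero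
    go a (yes a≤i) = reach-down (toℕ a) (FinP.toℕ<n a) (λ i′ i′<a → others∈S i′ (λ eq → ℕP.<-irrefl eq (ℕP.<-≤-trans i′<a a≤i)))
    go a (no  a≰i) = Reach-trans
      (reach-up (k ∸ toℕ a) (toℕ a) (FinP.toℕ<n a) (ℕP.m+[n∸m]≡n (ℕP.≤-pred (FinP.toℕ<n a)))
                (λ i′ a≤i′ → others∈S i′ (λ eq → a≰i (subst (toℕ a ≤_) eq a≤i′))))
      (step (adjacent-parallel j j∈S) here)

  -- Without the series edges i < i′, no edge of S leaves the vertices i+1, …, i′.
  series-gap-disconnected : Connected G S → (i i′ : Fin k) → toℕ i < toℕ i′ →
                            lookup S (i ↑ˡ m) ≡ false → lookup S (i′ ↑ˡ m) ≡ false → ⊥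
  series-gap-disconnected connected i i′ i<i′ i∉S i′∉S =
    ℕP.<-irrefl refl (ℕP.<-≤-trans (proj₁ (reach-preserves (connected start Fin.zero) start-between)) z≤n)
    where
    Between : Fin (suc k) → Set
    Between v = toℕ i < toℕ v × toℕ v ≤ toℕ i′

    distinct : ∀ {i₀ c : Fin k} → lookup S (i₀ ↑ˡ m) ≡ true → lookup S (c ↑ˡ m) ≡ false → toℕ i₀ ≢ toℕ c
    distinct i₀∈S c∉S eq with FinP.toℕ-injective eq
    ... | refl with trans (sym i₀∈S) c∉S
    ...   | ()

    edge-preserves : ∀ {u v e} → EdgeView k m e → e Subset.∈ S →
                     (ends G e ≡ (u , v)) ⊎ (ends G e ≡ (v , u)) → Between u → Between v
    edge-preserves (series i₀) e∈S ends≡ (i<u , u≤i′) with ends-series↑ i₀ | VecP.[]=⇒lookup e∈S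
    edge-preserves (series i₀) e∈S (inj₁ refl) (i<u , u≤i′) | u≡i₀ , v≡1+i₀ | i₀∈S =
      subst (toℕ i <_) (sym v≡1+i₀) (ℕP.m<n⇒m<1+n (subst (toℕ i <_) u≡i₀ i<u)) ,
      subst (_≤ toℕ i′) (sym v≡1+i₀) (ℕP.≤∧≢⇒< (subst (_≤ toℕ i′) u≡i₀ u≤i′) (distinct i₀∈S i′∉S))
    edge-preserves (series i₀) e∈S (inj₂ refl) (i<u , u≤i′) | v≡i₀ , u≡1+i₀ | i₀∈S =
      subst (toℕ i <_) (sym v≡i₀) (ℕP.≤∧≢⇒< (ℕP.≤-pred (subst (toℕ i <_) u≡1+i₀ i<u)) (distinct i₀∈S i∉S ∘ sym)) ,
      subst (_≤ toℕ i′) (sym v≡i₀) (ℕP.≤-trans (ℕP.n≤1+n _) (subst (_≤ toℕ i′) u≡1+i₀ u≤i′))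
    edge-preserves (parallel j) _ (inj₁ ends≡) (_ , u≤i′) with trans (sym ends≡) (ends-parallel↑ j)
    ... | refl = ⊥-elim (ℕP.<-irrefl refl (ℕP.≤-<-trans (subst (_≤ toℕ i′) (FinP.toℕ-fromℕ k) u≤i′) (FinP.toℕ<n i′)))
    edge-preserves (parallel j) _ (inj₂ ends≡) (i<u , _) with trans (sym ends≡) (ends-parallel↑ j)
    ... | refl = ⊥-elim (ℕP.<-irrefl refl (ℕP.<-≤-trans i<u z≤n))

    reach-preserves : ∀ {u v} → Reach G S u v → Between u → Between v
    reach-preserves here                     between = between
    reach-preserves (step (adj e e∈S ends≡) r) between = reach-preserves r (edge-preserves (edgeView k m e) e∈S ends≡ between)

    start : Fin (suc k)
    start = Fin.fromℕ< (s≤s (FinP.toℕ<n i))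

    start-between : Between start
    start-between = subst (toℕ i <_) (sym (FinP.toℕ-fromℕ< (s≤s (FinP.toℕ<n i)))) ℕP.≤-refl ,
                    subst (_≤ toℕ i′) (sym (FinP.toℕ-fromℕ< (s≤s (FinP.toℕ<n i)))) i<i′

-- Lattice points are feasible

weighted : ∀ {n} → List (Subset n × ℚ) → (Subset n → ℚ) → ℚ
weighted []            f = 0ℚ
weighted ((B , c) ∷ L) f = c ℚ.* f B ℚ.+ weighted L f

combo≡weighted : ∀ {n} (L : List (Subset n × ℚ)) i → combo L i ≡ weighted L (λ B → indicator B i)
combo≡weighted []            i = refl
combo≡weighted ((B , c) ∷ L) i = cong (c ℚ.* indicator B i ℚ.+_) (combo≡weighted L i)

∑ℚ-weighted : ∀ {n n′} (L : List (Subset n × ℚ)) (F : Fin n′ → Subset n → ℚ) →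
              ∑ℚ.sum (λ i → weighted L (F i)) ≡ weighted L (λ B → ∑ℚ.sum (λ i → F i B))
∑ℚ-weighted {n′ = n′} []            F = ∑ℚ.sum-replicate-zero n′
∑ℚ-weighted {n′ = n′} ((B , c) ∷ L) F = trans (∑ℚ.∑-distrib-+ {n′} (λ i → c ℚ.* F i B) (λ i → weighted L (F i)))
  (cong₂ ℚ._+_ (sym (∑ℚ.*-distribˡ-sum {n′} c (λ i → F i B))) (∑ℚ-weighted L F))

weighted-mono : ∀ {n} (L : List (Subset n × ℚ)) {f g : Subset n → ℚ} → Allˡ.All (λ p → 0ℚ ℚ.≤ proj₂ p) L →
                Allˡ.All (λ p → f (proj₁ p) ℚ.≤ g (proj₁ p)) L → weighted L f ℚ.≤ weighted L g
weighted-mono []            _                _              = ℚP.≤-refl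
weighted-mono ((B , c) ∷ L) (c≥0 Allˡ.∷ cs≥0) (fB≤gB Allˡ.∷ f≤g) =
  ℚP.+-mono-≤ (ℚP.*-monoˡ-≤-nonNeg c {{ℚ.nonNegative c≥0}} fB≤gB) (weighted-mono L cs≥0 f≤g)

weighted-const : ∀ {n} (L : List (Subset n × ℚ)) q → weighted L (λ _ → q) ≡ weightSum L ℚ.* q
weighted-const []            q = sym (ℚP.*-zeroˡ q)
weighted-const ((B , c) ∷ L) q = trans (cong (c ℚ.* q ℚ.+_) (weighted-const L q)) (sym (ℚP.*-distribʳ-+ q c (weightSum L)))

weighted-cong : ∀ {n} (L : List (Subset n × ℚ)) {f g : Subset n → ℚ} →
                Allˡ.All (λ p → f (proj₁ p) ≡ g (proj₁ p)) L → weighted L f ≡ weighted L g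
weighted-cong []            _                   = refl
weighted-cong ((B , c) ∷ L) (fB≡gB Allˡ.∷ f≡g) = cong₂ ℚ._+_ (cong (c ℚ.*_) fB≡gB) (weighted-cong L f≡g)

-- A point of the polytope satisfies every linear constraint that all indicator vectors of bases satisfy.
module PolytopePoint {n} {IsBasis : Subset n → Set} {z : Fin n → ℚ} (z∈P : InMatroidPolytope IsBasis z) where
  L : List (Subset n × ℚ)
  L = proj₁ z∈P

  bases : Allˡ.All (λ p → IsBasis (proj₁ p)) L
  bases = proj₁ (proj₂ z∈P)

  nonNeg : Allˡ.All (λ p → 0ℚ ℚ.≤ proj₂ p) L
  nonNeg = proj₁ (proj₂ (proj₂ z∈P))

  total : weightSum L ≡ 1ℚ
  total = proj₁ (proj₂ (proj₂ (proj₂ z∈P)))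

  z≡combo : ∀ e → z e ≡ combo L e
  z≡combo = proj₂ (proj₂ (proj₂ (proj₂ z∈P)))

  ∑-coordinates : ∀ {n′} (g : Fin n′ → Fin n) → ∑ℚ.sum (z ∘ g) ≡ weighted L (λ B → ∑ℚ.sum (indicator B ∘ g))
  ∑-coordinates g = trans (∑ℚ.sum-cong-≗ (λ i → trans (z≡combo (g i)) (combo≡weighted L (g i))))
                          (∑ℚ-weighted L (λ i B → indicator B (g i)))

  coordinate : ∀ e → z e ≡ weighted L (λ B → indicator B e)
  coordinate e = trans (z≡combo e) (combo≡weighted L e)

  weighted-constant : ∀ c → weighted L (λ _ → c) ≡ c
  weighted-constant c = trans (weighted-const L c) (trans (cong (ℚ._* c) total) (ℚP.*-identityˡ c))

  weighted-≤ : ∀ {f c} → (∀ B → IsBasis B → f B ℚ.≤ c) → weighted L f ℚ.≤ c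
  weighted-≤ {f} {c} f≤c = subst (weighted L f ℚ.≤_) (weighted-constant c)
    (weighted-mono L nonNeg (Allˡ.map (λ {p} → f≤c (proj₁ p)) bases))

  weighted-≥ : ∀ {f c} → (∀ B → IsBasis B → c ℚ.≤ f B) → c ℚ.≤ weighted L f
  weighted-≥ {f} {c} c≤f = subst (ℚ._≤ weighted L f) (weighted-constant c)
    (weighted-mono L nonNeg (Allˡ.map (λ {p} → c≤f (proj₁ p)) bases))

  weighted-≡ : ∀ {f c} → (∀ B → IsBasis B → f B ≡ c) → weighted L f ≡ c
  weighted-≡ {c = c} f≡c = trans (weighted-cong L (Allˡ.map (λ {p} → f≡c (proj₁ p)) bases)) (weighted-constant c)

indicator-bounds : ∀ {n} (B : Subset n) i → 0ℚ ℚ.≤ indicator B i × indicator B i ℚ.≤ 1ℚ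
indicator-bounds B i with lookup B i
... | true  = ιℕ-nonNeg 1 , ℚP.≤-refl
... | false = ℚP.≤-refl , ιℕ-nonNeg 1

count-true : ∀ {n} (f : Fin n → Bool) → (∀ i → f i ≡ true) → count f ≡ n
count-true {zero}  f _      = refl
count-true {suc n} f f≡true rewrite f≡true Fin.zero = cong suc (count-true (f ∘ Fin.suc) (f≡true ∘ Fin.suc))

n≤1+count-if-single-false : ∀ {n} (f : Fin n → Bool) →
                            (∀ i i′ → toℕ i < toℕ i′ → f i ≡ false → f i′ ≡ false → ⊥) → n ≤ suc (count f)
n≤1+count-if-single-false {zero}  f _          = z≤n
n≤1+count-if-single-false {suc n} f two-falses with f Fin.zero in f₀≡
... | true  = s≤s (n≤1+count-if-single-false (f ∘ Fin.suc) (λ i i′ i<i′ → two-falses (Fin.suc i) (Fin.suc i′) (s≤s i<i′)))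
... | false = s≤s (ℕP.≤-reflexive (sym (count-true (f ∘ Fin.suc) rest-true)))
  where
  rest-true : ∀ i → f (Fin.suc i) ≡ true
  rest-true i with f (Fin.suc i) in fᵢ≡
  ... | true  = refl
  ... | false = ⊥-elim (two-falses Fin.zero (Fin.suc i) (s≤s z≤n) f₀≡ fᵢ≡)

sum-tabulate : ∀ {n} (f : Fin n → ℕ) → Vec.sum (Vec.tabulate f) ≡ sum f
sum-tabulate {zero}  f = refl
sum-tabulate {suc n} f = cong (f Fin.zero +_) (sum-tabulate (f ∘ Fin.suc))

sum-lookup : ∀ {n} (xs : Vec ℕ n) → sum (lookup xs) ≡ Vec.sum xs
sum-lookup []       = refl
sum-lookup (x ∷ xs) = cong (x +_) (sum-lookup xs)

module Necessity (k m t : ℕ) where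
  open FeasiblePoints k m t using (Feasible; point; lookup-point-series; lookup-point-parallel)

  module _ {B : Subset (k + m)} (B-basis : TBasis k (k + m) B) where

    count-basis : count (lookup B) ≡ k
    count-basis = trans (sym (∣p∣≡count B)) (proj₂ B-basis)

    -- A spanning tree misses at most one edge of the path 0 — 1 — ⋯ — k, so it has at most one parallel edge.
    count-parallel≤1 : count (λ j → lookup B (k ↑ʳ j)) ≤ 1
    count-parallel≤1 = ℕP.+-cancelˡ-≤ count-series _ _
      (subst (_≤ count-series + 1) (trans (sym count-basis) (sum-↑ ℕP.+-0-monoid k (boolToℕ ∘ lookup B)))
             (subst (k ≤_) (ℕP.+-comm 1 count-series)
                    (n≤1+count-if-single-false (λ i → lookup B (i ↑ˡ m))
                      (TGraphConnectivity.series-gap-disconnected k m B (proj₁ B-basis)))))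
      where count-series = count (λ i → lookup B (i ↑ˡ m))

    ∑-indicator : ∑ℚ.sum (indicator B) ≡ ιℕ k
    ∑-indicator = trans (∑ℚ.sum-cong-≗ (indicator≡ιℕ B)) (trans (sym (ιℕ-sum (boolToℕ ∘ lookup B))) (cong ιℕ count-basis))

    ∑-indicator-parallel≤1 : ∑ℚ.sum (λ j → indicator B (k ↑ʳ j)) ℚ.≤ 1ℚ
    ∑-indicator-parallel≤1 = subst (ℚ._≤ 1ℚ)
      (sym (trans (∑ℚ.sum-cong-≗ (λ j → indicator≡ιℕ B (k ↑ʳ j))) (sym (ιℕ-sum (λ j → boolToℕ (lookup B (k ↑ʳ j)))))))
      (ιℕ-mono-≤ count-parallel≤1)

  module _ {x : Vec ℤ (k + m)} (x∈tP : InDilateLattice (TBasis k (k + m)) t x) where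
    z : Fin (k + m) → ℚ
    z = proj₁ x∈tP
    open PolytopePoint (proj₁ (proj₂ x∈tP))

    x≡tz : ∀ e → ι (lookup x e) ≡ ιℕ t ℚ.* z e
    x≡tz = proj₂ (proj₂ x∈tP)

    z≥0 : ∀ e → 0ℚ ℚ.≤ z e
    z≥0 e = subst (0ℚ ℚ.≤_) (sym (coordinate e)) (weighted-≥ (λ B _ → proj₁ (indicator-bounds B e)))

    z≤1 : ∀ e → z e ℚ.≤ 1ℚ
    z≤1 e = subst (ℚ._≤ 1ℚ) (sym (coordinate e)) (weighted-≤ (λ B _ → proj₂ (indicator-bounds B e)))

    ∑z≡k : ∑ℚ.sum z ≡ ιℕ k
    ∑z≡k = trans (∑-coordinates (λ e → e)) (weighted-≡ (λ B B-basis → ∑-indicator B-basis))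

    ∑z-parallel≤1 : ∑ℚ.sum (λ j → z (k ↑ʳ j)) ℚ.≤ 1ℚ
    ∑z-parallel≤1 = subst (ℚ._≤ 1ℚ) (sym (∑-coordinates (k ↑ʳ_))) (weighted-≤ (λ B B-basis → ∑-indicator-parallel≤1 B-basis))

    x≥0 : ∀ e → ℤ.0ℤ ℤ.≤ lookup x e
    x≥0 e = ι-cancel-≤ (subst (0ℚ ℚ.≤_) (sym (x≡tz e))
      (subst (ℚ._≤ ιℕ t ℚ.* z e) (ℚP.*-zeroʳ (ιℕ t)) (ιℕ-*-monoʳ-≤ t (z≥0 e))))

    ∣x∣≡tz : ∀ e → ιℕ ℤ.∣ lookup x e ∣ ≡ ιℕ t ℚ.* z e
    ∣x∣≡tz e = trans (cong ι (ℤP.0≤i⇒+∣i∣≡i (x≥0 e))) (x≡tz e)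

    coordinates : ∀ {n′} → (Fin n′ → Fin (k + m)) → Vec ℕ n′
    coordinates g = Vec.tabulate (λ i → ℤ.∣ lookup x (g i) ∣)

    ys : Vec ℕ k
    ys = coordinates (_↑ˡ m)

    w : Vec ℕ m
    w = coordinates (k ↑ʳ_)

    sum-coordinates : ∀ {n′} (g : Fin n′ → Fin (k + m)) → ιℕ (Vec.sum (coordinates g)) ≡ ιℕ t ℚ.* ∑ℚ.sum (z ∘ g)
    sum-coordinates {n′} g = begin
      ιℕ (Vec.sum (coordinates g))             ≡⟨ cong ιℕ (sum-tabulate (λ i → ℤ.∣ lookup x (g i) ∣)) ⟩
      ιℕ (sum (λ i → ℤ.∣ lookup x (g i) ∣))    ≡⟨ ιℕ-sum (λ i → ℤ.∣ lookup x (g i) ∣) ⟩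
      ∑ℚ.sum (λ i → ιℕ ℤ.∣ lookup x (g i) ∣)   ≡⟨ ∑ℚ.sum-cong-≗ (∣x∣≡tz ∘ g) ⟩
      ∑ℚ.sum (λ i → ιℕ t ℚ.* z (g i))          ≡⟨ sym (∑ℚ.*-distribˡ-sum {n′} (ιℕ t) (z ∘ g)) ⟩
      ιℕ t ℚ.* ∑ℚ.sum (z ∘ g)                  ∎

    x≡point : x ≡ point ys w
    x≡point = trans (sym (VecP.tabulate∘lookup x)) (trans (VecP.tabulate-cong (λ e → coordinate≡ e (edgeView k m e))) (VecP.tabulate∘lookup _))
      where
      coordinate≡ : ∀ e → EdgeView k m e → lookup x e ≡ lookup (point ys w) e
      coordinate≡ _ (series i) = sym (begin
        lookup (point ys w) (i ↑ˡ m)                 ≡⟨ lookup-point-series ys w i ⟩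
        ℤ.+ lookup ys i                              ≡⟨ cong ℤ.+_ (VecP.lookup∘tabulate (λ i → ℤ.∣ lookup x (i ↑ˡ m) ∣) i) ⟩
        ℤ.+ ℤ.∣ lookup x (i ↑ˡ m) ∣                  ≡⟨ ℤP.0≤i⇒+∣i∣≡i (x≥0 (i ↑ˡ m)) ⟩
        lookup x (i ↑ˡ m)                            ∎)
      coordinate≡ _ (parallel j) = sym (begin
        lookup (point ys w) (k ↑ʳ j)                 ≡⟨ lookup-point-parallel ys w j ⟩
        ℤ.+ lookup w j                               ≡⟨ cong ℤ.+_ (VecP.lookup∘tabulate (λ j → ℤ.∣ lookup x (k ↑ʳ j) ∣) j) ⟩
        ℤ.+ ℤ.∣ lookup x (k ↑ʳ j) ∣                  ≡⟨ ℤP.0≤i⇒+∣i∣≡i (x≥0 (k ↑ʳ j)) ⟩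
        lookup x (k ↑ʳ j)                            ∎)

    ys≤t : Allᵛ.All (_≤ t) ys
    ys≤t = AllᵛP.tabulate⁺ (λ i → ιℕ-cancel-≤ (subst₂ ℚ._≤_ (sym (∣x∣≡tz (i ↑ˡ m))) (ℚP.*-identityʳ (ιℕ t))
                                                      (ιℕ-*-monoʳ-≤ t (z≤1 (i ↑ˡ m)))))

    ∑w≤t : Vec.sum w ≤ t
    ∑w≤t = ιℕ-cancel-≤ (subst₂ ℚ._≤_ (sym (sum-coordinates (k ↑ʳ_))) (ℚP.*-identityʳ (ιℕ t)) (ιℕ-*-monoʳ-≤ t ∑z-parallel≤1))

    ∑ys+∑w≡kt : Vec.sum ys + Vec.sum w ≡ k * t
    ∑ys+∑w≡kt = ιℕ-injective (begin
      ιℕ (Vec.sum ys + Vec.sum w)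
        ≡⟨ ιℕ-homo-+ (Vec.sum ys) (Vec.sum w) ⟩
      ιℕ (Vec.sum ys) ℚ.+ ιℕ (Vec.sum w)
        ≡⟨ cong₂ ℚ._+_ (sum-coordinates (_↑ˡ m)) (sum-coordinates (k ↑ʳ_)) ⟩
      ιℕ t ℚ.* ∑ℚ.sum (z ∘ (_↑ˡ m)) ℚ.+ ιℕ t ℚ.* ∑ℚ.sum (z ∘ (k ↑ʳ_))
        ≡⟨ sym (ℚP.*-distribˡ-+ (ιℕ t) _ _) ⟩
      ιℕ t ℚ.* (∑ℚ.sum (z ∘ (_↑ˡ m)) ℚ.+ ∑ℚ.sum (z ∘ (k ↑ʳ_)))
        ≡⟨ cong (ιℕ t ℚ.*_) (sym (sum-↑ ℚP.+-0-monoid k z)) ⟩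
      ιℕ t ℚ.* ∑ℚ.sum z
        ≡⟨ cong (ιℕ t ℚ.*_) ∑z≡k ⟩
      ιℕ t ℚ.* ιℕ k
        ≡⟨ sym (ιℕ-homo-* t k) ⟩
      ιℕ (t * k)
        ≡⟨ cong ιℕ (ℕP.*-comm t k) ⟩
      ιℕ (k * t) ∎)

    latticePoint⇒feasible : Feasible x
    latticePoint⇒feasible = ys , w , x≡point , ys≤t , ∑w≤t , ∑ys+∑w≡kt

-- Feasible points are lattice points

_==_ : ∀ {n} → Fin n → Fin n → Bool
i == j = does (i FinP.≟ j)

==-refl : ∀ {n} (i : Fin n) → (i == i) ≡ true
==-refl i with i FinP.≟ i
... | yes _  = refl
... | no i≢i = ⊥-elim (i≢i refl)

==-≢ : ∀ {n} (i j : Fin n) → toℕ i ≢ toℕ j → (i == j) ≡ false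
==-≢ i j i≢j with i FinP.≟ j
... | yes refl = ⊥-elim (i≢j refl)
... | no  _    = refl

lookup-⁅⁆ : ∀ {n} (i j : Fin n) → lookup Subset.⁅ i ⁆ j ≡ (i == j)
lookup-⁅⁆ Fin.zero    Fin.zero    = refl
lookup-⁅⁆ Fin.zero    (Fin.suc j) = VecP.lookup-replicate j false
lookup-⁅⁆ (Fin.suc i) Fin.zero    = refl
lookup-⁅⁆ (Fin.suc i) (Fin.suc j) = lookup-⁅⁆ i j

∣p++q∣ : ∀ {k m} (p : Subset k) (q : Subset m) → ∣ p Vec.++ q ∣ ≡ ∣ p ∣ + ∣ q ∣
∣p++q∣ []          q = refl
∣p++q∣ (true ∷ p)  q = cong suc (∣p++q∣ p q)
∣p++q∣ (false ∷ p) q = ∣p++q∣ p q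

countˡ : ∀ {A : Set} → (A → Bool) → List A → ℕ
countˡ f []       = 0
countˡ f (x ∷ xs) = boolToℕ (f x) + countˡ f xs

countˡ-++ : ∀ {A : Set} (f : A → Bool) xs ys → countˡ f (xs ++ ys) ≡ countˡ f xs + countˡ f ys
countˡ-++ f []       ys = refl
countˡ-++ f (x ∷ xs) ys = trans (cong (boolToℕ (f x) +_) (countˡ-++ f xs ys)) (sym (ℕP.+-assoc (boolToℕ (f x)) _ _))

countˡ-map : ∀ {A B : Set} (f : B → Bool) (g : A → B) xs → countˡ f (List.map g xs) ≡ countˡ (f ∘ g) xs
countˡ-map f g []       = refl
countˡ-map f g (x ∷ xs) = cong (boolToℕ (f (g x)) +_) (countˡ-map f g xs)

countˡ-cong : ∀ {A : Set} {f g : A → Bool} → (∀ x → f x ≡ g x) → ∀ xs → countˡ f xs ≡ countˡ g xs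
countˡ-cong f≡g []       = refl
countˡ-cong f≡g (x ∷ xs) = cong₂ _+_ (cong boolToℕ (f≡g x)) (countˡ-cong f≡g xs)

countˡ-not : ∀ {A : Set} (f : A → Bool) xs → countˡ (not ∘ f) xs + countˡ f xs ≡ length xs
countˡ-not f []       = refl
countˡ-not f (x ∷ xs) with f x
... | true  = trans (ℕP.+-suc (countˡ (not ∘ f) xs) _) (cong suc (countˡ-not f xs))
... | false = cong suc (countˡ-not f xs)

countˡ-replicate : ∀ {A : Set} (f : A → Bool) r x → countˡ f (List.replicate r x) ≡ r * boolToℕ (f x)
countˡ-replicate f zero    x = refl
countˡ-replicate f (suc r) x = cong (boolToℕ (f x) +_) (countˡ-replicate f r x)

countˡ-false : ∀ {A : Set} (xs : List A) → countˡ (λ _ → false) xs ≡ 0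
countˡ-false []       = refl
countˡ-false (x ∷ xs) = countˡ-false xs

multiset : ∀ {n} → (Fin n → ℕ) → List (Fin n)
multiset {zero}  d = []
multiset {suc n} d = List.replicate (d Fin.zero) Fin.zero ++ List.map Fin.suc (multiset (d ∘ Fin.suc))

length-multiset : ∀ {n} (d : Fin n → ℕ) → length (multiset d) ≡ sum d
length-multiset {zero}  d = refl
length-multiset {suc n} d = trans (ListP.length-++ (List.replicate (d Fin.zero) Fin.zero))
  (cong₂ _+_ (ListP.length-replicate (d Fin.zero))
             (trans (ListP.length-map Fin.suc (multiset (d ∘ Fin.suc))) (length-multiset (d ∘ Fin.suc))))

countˡ-multiset : ∀ {n} (d : Fin n → ℕ) i → countˡ (_== i) (multiset d) ≡ d i
countˡ-multiset {suc n} d Fin.zero = begin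
  countˡ (_== Fin.zero) (List.replicate (d Fin.zero) Fin.zero ++ List.map Fin.suc rest)
    ≡⟨ countˡ-++ (_== Fin.zero) (List.replicate (d Fin.zero) Fin.zero) _ ⟩
  countˡ (_== Fin.zero) (List.replicate (d Fin.zero) Fin.zero) + countˡ (_== Fin.zero) (List.map Fin.suc rest)
    ≡⟨ cong₂ _+_ (countˡ-replicate (_== Fin.zero) (d Fin.zero) Fin.zero) (trans (countˡ-map (_== Fin.zero) Fin.suc rest) (countˡ-false rest)) ⟩
  d Fin.zero * 1 + 0
    ≡⟨ trans (ℕP.+-identityʳ _) (ℕP.*-identityʳ _) ⟩
  d Fin.zero ∎
  where rest = multiset (d ∘ Fin.suc)
countˡ-multiset {suc n} d (Fin.suc i) = begin
  countˡ (_== Fin.suc i) (List.replicate (d Fin.zero) Fin.zero ++ List.map Fin.suc rest)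
    ≡⟨ countˡ-++ (_== Fin.suc i) (List.replicate (d Fin.zero) Fin.zero) _ ⟩
  countˡ (_== Fin.suc i) (List.replicate (d Fin.zero) Fin.zero) + countˡ (_== Fin.suc i) (List.map Fin.suc rest)
    ≡⟨ cong₂ _+_ (trans (countˡ-replicate (_== Fin.suc i) (d Fin.zero) Fin.zero) (ℕP.*-zeroʳ (d Fin.zero)))
                 (countˡ-map (_== Fin.suc i) Fin.suc rest) ⟩
  countˡ (_== i) rest
    ≡⟨ countˡ-multiset (d ∘ Fin.suc) i ⟩
  d (Fin.suc i) ∎
  where rest = multiset (d ∘ Fin.suc)

unzip-zip : ∀ {A B : Set} (xs : List A) (ys : List B) → length xs ≡ length ys →
            List.map proj₁ (List.zip xs ys) ≡ xs × List.map proj₂ (List.zip xs ys) ≡ ys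
unzip-zip []       []       _  = refl , refl
unzip-zip (x ∷ xs) (y ∷ ys) eq with unzip-zip xs ys (ℕP.suc-injective eq)
... | eq₁ , eq₂ = cong (x ∷_) eq₁ , cong (y ∷_) eq₂

uniform : ∀ {n} → ℚ → List (Subset n) → List (Subset n × ℚ)
uniform c = List.map (λ B → (B , c))

combo-uniform : ∀ {n} c (Bs : List (Subset n)) e → combo (uniform c Bs) e ≡ c ℚ.* ιℕ (countˡ (λ B → lookup B e) Bs)
combo-uniform c []       e = sym (ℚP.*-zeroʳ c)
combo-uniform c (B ∷ Bs) e = begin
  c ℚ.* indicator B e ℚ.+ combo (uniform c Bs) e
    ≡⟨ cong₂ (λ u v → c ℚ.* u ℚ.+ v) (indicator≡ιℕ B e) (combo-uniform c Bs e) ⟩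
  c ℚ.* ιℕ (boolToℕ (lookup B e)) ℚ.+ c ℚ.* ιℕ (countˡ (λ B → lookup B e) Bs)
    ≡⟨ sym (ℚP.*-distribˡ-+ c _ _) ⟩
  c ℚ.* (ιℕ (boolToℕ (lookup B e)) ℚ.+ ιℕ (countˡ (λ B → lookup B e) Bs))
    ≡⟨ cong (c ℚ.*_) (sym (ιℕ-homo-+ (boolToℕ (lookup B e)) _)) ⟩
  c ℚ.* ιℕ (countˡ (λ B → lookup B e) (B ∷ Bs)) ∎

weightSum-uniform : ∀ {n} c (Bs : List (Subset n)) → weightSum (uniform c Bs) ≡ c ℚ.* ιℕ (length Bs)
weightSum-uniform c []       = sym (ℚP.*-zeroʳ c)
weightSum-uniform c (B ∷ Bs) = begin
  c ℚ.+ weightSum (uniform c Bs)          ≡⟨ cong₂ ℚ._+_ (sym (ℚP.*-identityʳ c)) (weightSum-uniform c Bs) ⟩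
  c ℚ.* 1ℚ ℚ.+ c ℚ.* ιℕ (length Bs)       ≡⟨ sym (ℚP.*-distribˡ-+ c 1ℚ _) ⟩
  c ℚ.* (ιℕ 1 ℚ.+ ιℕ (length Bs))         ≡⟨ cong (c ℚ.*_) (sym (ιℕ-homo-+ 1 (length Bs))) ⟩
  c ℚ.* ιℕ (suc (length Bs))              ∎

module Sufficiency (k m : ℕ) where
  open FeasiblePoints k m using (Feasible; point; lookup-point-series; lookup-point-parallel; sum-complement; complement)

  seriesBasis : Subset (k + m)
  seriesBasis = Subset.⊤ {k} Vec.++ Subset.⊥ {m}

  exchangeBasis : Fin k × Fin m → Subset (k + m)
  exchangeBasis (i , j) = Subset.∁ Subset.⁅ i ⁆ Vec.++ Subset.⁅ j ⁆

  seriesBasis-series : ∀ i → lookup seriesBasis (i ↑ˡ m) ≡ true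
  seriesBasis-series i = trans (VecP.lookup-++ˡ (Subset.⊤ {k}) (Subset.⊥ {m}) i) (VecP.lookup-replicate i true)

  seriesBasis-parallel : ∀ j → lookup seriesBasis (k ↑ʳ j) ≡ false
  seriesBasis-parallel j = trans (VecP.lookup-++ʳ (Subset.⊤ {k}) (Subset.⊥ {m}) j) (VecP.lookup-replicate j false)

  exchangeBasis-series : ∀ p i′ → lookup (exchangeBasis p) (i′ ↑ˡ m) ≡ not (proj₁ p == i′)
  exchangeBasis-series (i , j) i′ = trans (VecP.lookup-++ˡ (Subset.∁ Subset.⁅ i ⁆) Subset.⁅ j ⁆ i′)
    (trans (VecP.lookup-map i′ not Subset.⁅ i ⁆) (cong not (lookup-⁅⁆ i i′)))

  exchangeBasis-parallel : ∀ p j′ → lookup (exchangeBasis p) (k ↑ʳ j′) ≡ (proj₂ p == j′)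
  exchangeBasis-parallel (i , j) j′ = trans (VecP.lookup-++ʳ (Subset.∁ Subset.⁅ i ⁆) Subset.⁅ j ⁆ j′) (lookup-⁅⁆ j j′)

  seriesBasis-isBasis : TBasis k (k + m) seriesBasis
  seriesBasis-isBasis =
    TGraphConnectivity.series-connected k m seriesBasis seriesBasis-series ,
    trans (∣p++q∣ (Subset.⊤ {k}) (Subset.⊥ {m})) (trans (cong₂ _+_ (SubsetP.∣⊤∣≡n k) (SubsetP.∣⊥∣≡0 m)) (ℕP.+-identityʳ k))

  exchangeBasis-isBasis : ∀ p → TBasis k (k + m) (exchangeBasis p)
  exchangeBasis-isBasis (i , j) =
    TGraphConnectivity.exchange-connected k m (exchangeBasis (i , j)) i j
      (λ i′ i′≢i → trans (exchangeBasis-series (i , j) i′) (cong not (==-≢ i i′ (i′≢i ∘ sym))))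
      (trans (exchangeBasis-parallel (i , j) j) (==-refl j)) ,
    (begin
      ∣ Subset.∁ Subset.⁅ i ⁆ Vec.++ Subset.⁅ j ⁆ ∣     ≡⟨ ∣p++q∣ (Subset.∁ Subset.⁅ i ⁆) Subset.⁅ j ⁆ ⟩
      ∣ Subset.∁ Subset.⁅ i ⁆ ∣ + ∣ Subset.⁅ j ⁆ ∣       ≡⟨ cong₂ _+_ (SubsetP.∣∁p∣≡n∸∣p∣ Subset.⁅ i ⁆) (SubsetP.∣⁅x⁆∣≡1 j) ⟩
      k ∸ ∣ Subset.⁅ i ⁆ ∣ + 1                           ≡⟨ cong (λ c → k ∸ c + 1) (SubsetP.∣⁅x⁆∣≡1 i) ⟩
      k ∸ 1 + 1                                          ≡⟨ ℕP.m∸n+n≡m (ℕP.≤-trans (s≤s z≤n) (FinP.toℕ<n i)) ⟩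
      k                                                  ∎)

  zero-dilate : ∀ x → Feasible 0 x → InDilateLattice (TBasis k (k + m)) 0 x
  zero-dilate x (ys , w , refl , ys≤0 , ∑w≤0 , _) =
    combo L , (L , seriesBasis-isBasis Allˡ.∷ Allˡ.[] , ιℕ-nonNeg 1 Allˡ.∷ Allˡ.[] , ℚP.+-identityʳ 1ℚ , λ _ → refl) ,
    λ e → trans (coordinate≡0 e (edgeView k m e)) (sym (ℚP.*-zeroˡ (combo L e)))
    where
    L = (seriesBasis , 1ℚ) ∷ []
    coordinate≡0 : ∀ e → EdgeView k m e → ι (lookup (point 0 ys w) e) ≡ 0ℚ
    coordinate≡0 _ (series i)   = trans (cong ι (lookup-point-series 0 ys w i)) (cong ιℕ (ℕP.n≤0⇒n≡0 (AllᵛP.lookup⁺ ys≤0 i)))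
    coordinate≡0 _ (parallel j) = trans (cong ι (lookup-point-parallel 0 ys w j))
      (cong ιℕ (ℕP.n≤0⇒n≡0 (ℕP.≤-trans (AllᵛP.lookup⁺ (entries≤sum w) j) ∑w≤0)))

  -- seriesBasis fills the t ∸ Σ w places not taken by exchanges, so each edge e lies in exactly x_e of the t bases.
  module Decomposition (t′ : ℕ) (ys : Vec ℕ k) (w : Vec ℕ m) (ys≤t : Allᵛ.All (_≤ suc t′) ys)
                       (∑w≤t : Vec.sum w ≤ suc t′) (∑≡kt : Vec.sum ys + Vec.sum w ≡ k * suc t′) where
    t s : ℕ
    t = suc t′
    s = Vec.sum w

    deficit : Fin k → ℕ
    deficit i = t ∸ lookup ys i

    pairs : List (Fin k × Fin m)
    pairs = List.zip (multiset deficit) (multiset (lookup w))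

    bases : List (Subset (k + m))
    bases = List.map exchangeBasis pairs ++ List.replicate (t ∸ s) seriesBasis

    ∑deficit≡s : sum deficit ≡ s
    ∑deficit≡s = begin
      sum deficit                          ≡⟨ sum-cong-≗ {k} (λ i → sym (VecP.lookup-map i (t ∸_) ys)) ⟩
      sum (lookup (complement t ys))       ≡⟨ sum-lookup (complement t ys) ⟩
      Vec.sum (complement t ys)            ≡⟨ ℕP.+-cancelʳ-≡ (Vec.sum ys) _ _ (trans (sum-complement t ys ys≤t)
                                                (trans (sym ∑≡kt) (ℕP.+-comm (Vec.sum ys) s))) ⟩
      s                                    ∎

    length-deficits : length (multiset deficit) ≡ s
    length-deficits = trans (length-multiset deficit) ∑deficit≡s

    length-units : length (multiset (lookup w)) ≡ s
    length-units = trans (length-multiset (lookup w)) (sum-lookup w)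

    unzip-pairs : List.map proj₁ pairs ≡ multiset deficit × List.map proj₂ pairs ≡ multiset (lookup w)
    unzip-pairs = unzip-zip (multiset deficit) (multiset (lookup w)) (trans length-deficits (sym length-units))

    length-pairs : length pairs ≡ s
    length-pairs = trans (sym (ListP.length-map proj₁ pairs)) (trans (cong length (proj₁ unzip-pairs)) length-deficits)

    length-bases : length bases ≡ t
    length-bases = trans (ListP.length-++ (List.map exchangeBasis pairs))
      (trans (cong₂ _+_ (trans (ListP.length-map exchangeBasis pairs) length-pairs) (ListP.length-replicate (t ∸ s)))
             (ℕP.m+[n∸m]≡n ∑w≤t))

    occurrences : Fin (k + m) → ℕ
    occurrences e = countˡ (λ B → lookup B e) bases

    occurrences-split : ∀ e → occurrences e ≡
      countˡ (λ p → lookup (exchangeBasis p) e) pairs + (t ∸ s) * boolToℕ (lookup seriesBasis e)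
    occurrences-split e = trans (countˡ-++ (λ B → lookup B e) (List.map exchangeBasis pairs) _)
      (cong₂ _+_ (countˡ-map (λ B → lookup B e) exchangeBasis pairs) (countˡ-replicate (λ B → lookup B e) (t ∸ s) seriesBasis))

    occurrences-series : ∀ i → occurrences (i ↑ˡ m) ≡ lookup ys i
    occurrences-series i = ℕP.+-cancelʳ-≡ (deficit i) _ _ (begin
      occurrences (i ↑ˡ m) + deficit i
        ≡⟨ cong (_+ deficit i) (occurrences-split (i ↑ˡ m)) ⟩
      countˡ (λ p → lookup (exchangeBasis p) (i ↑ˡ m)) pairs + (t ∸ s) * boolToℕ (lookup seriesBasis (i ↑ˡ m)) + deficit i
        ≡⟨ cong₂ (λ u v → u + (t ∸ s) * boolToℕ v + deficit i)
                 (countˡ-cong (λ p → exchangeBasis-series p i) pairs) (seriesBasis-series i) ⟩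
      others + (t ∸ s) * 1 + deficit i
        ≡⟨ cong (λ u → others + (t ∸ s) * 1 + u) (sym paired-with-i) ⟩
      others + (t ∸ s) * 1 + countˡ (λ p → proj₁ p == i) pairs
        ≡⟨ solve 3 (λ u v r → u :+ v :* con 1 :+ r := (u :+ r) :+ v) refl others (t ∸ s) (countˡ (λ p → proj₁ p == i) pairs) ⟩
      others + countˡ (λ p → proj₁ p == i) pairs + (t ∸ s)
        ≡⟨ cong (_+ (t ∸ s)) (trans (countˡ-not (λ p → proj₁ p == i) pairs) length-pairs) ⟩
      s + (t ∸ s)
        ≡⟨ ℕP.m+[n∸m]≡n ∑w≤t ⟩
      t
        ≡⟨ sym (ℕP.m+[n∸m]≡n (AllᵛP.lookup⁺ ys≤t i)) ⟩
      lookup ys i + deficit i ∎)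
      where
      others = countˡ (λ p → not (proj₁ p == i)) pairs
      paired-with-i : countˡ (λ p → proj₁ p == i) pairs ≡ deficit i
      paired-with-i = trans (sym (countˡ-map (_== i) proj₁ pairs))
        (trans (cong (countˡ (_== i)) (proj₁ unzip-pairs)) (countˡ-multiset deficit i))

    occurrences-parallel : ∀ j → occurrences (k ↑ʳ j) ≡ lookup w j
    occurrences-parallel j = begin
      occurrences (k ↑ʳ j)
        ≡⟨ occurrences-split (k ↑ʳ j) ⟩
      countˡ (λ p → lookup (exchangeBasis p) (k ↑ʳ j)) pairs + (t ∸ s) * boolToℕ (lookup seriesBasis (k ↑ʳ j))
        ≡⟨ cong₂ (λ u v → u + (t ∸ s) * boolToℕ v)
                 (countˡ-cong (λ p → exchangeBasis-parallel p j) pairs) (seriesBasis-parallel j) ⟩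
      countˡ (λ p → proj₂ p == j) pairs + (t ∸ s) * 0
        ≡⟨ trans (cong (countˡ (λ p → proj₂ p == j) pairs +_) (ℕP.*-zeroʳ (t ∸ s))) (ℕP.+-identityʳ _) ⟩
      countˡ (λ p → proj₂ p == j) pairs
        ≡⟨ sym (countˡ-map (_== j) proj₂ pairs) ⟩
      countˡ (_== j) (List.map proj₂ pairs)
        ≡⟨ cong (countˡ (_== j)) (proj₂ unzip-pairs) ⟩
      countˡ (_== j) (multiset (lookup w))
        ≡⟨ countˡ-multiset (lookup w) j ⟩
      lookup w j ∎

    L : List (Subset (k + m) × ℚ)
    L = uniform (1/suc t′) bases

    t*combo : ∀ e → ιℕ t ℚ.* combo L e ≡ ιℕ (occurrences e)
    t*combo e = begin
      ιℕ t ℚ.* combo L e                            ≡⟨ cong (ιℕ t ℚ.*_) (combo-uniform (1/suc t′) bases e) ⟩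
      ιℕ t ℚ.* (1/suc t′ ℚ.* ιℕ (occurrences e))    ≡⟨ sym (ℚP.*-assoc (ιℕ t) (1/suc t′) _) ⟩
      ιℕ t ℚ.* 1/suc t′ ℚ.* ιℕ (occurrences e)      ≡⟨ cong (ℚ._* ιℕ (occurrences e)) (ιℕ-*-1/suc t′) ⟩
      1ℚ ℚ.* ιℕ (occurrences e)                     ≡⟨ ℚP.*-identityˡ _ ⟩
      ιℕ (occurrences e)                            ∎

    latticePoint : InDilateLattice (TBasis k (k + m)) t (point t ys w)
    latticePoint = combo L , (L , bases-areBases , weights-nonNeg , weights-sum , λ _ → refl) ,
                   λ e → trans (coordinate≡ e (edgeView k m e)) (sym (t*combo e))
      where
      bases-areBases : Allˡ.All (λ p → TBasis k (k + m) (proj₁ p)) L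
      bases-areBases = AllˡP.map⁺ (AllˡP.++⁺ (AllˡP.map⁺ (Allˡ.tabulate (λ {p} _ → exchangeBasis-isBasis p)))
                                             (AllˡP.replicate⁺ (t ∸ s) seriesBasis-isBasis))
      weights-nonNeg : Allˡ.All (λ p → 0ℚ ℚ.≤ proj₂ p) L
      weights-nonNeg = AllˡP.map⁺ (Allˡ.tabulate (λ _ → 1/suc-nonNeg t′))
      weights-sum : weightSum L ≡ 1ℚ
      weights-sum = trans (weightSum-uniform (1/suc t′) bases)
        (trans (cong (λ u → 1/suc t′ ℚ.* ιℕ u) length-bases) (trans (ℚP.*-comm (1/suc t′) (ιℕ t)) (ιℕ-*-1/suc t′)))
      coordinate≡ : ∀ e → EdgeView k m e → ι (lookup (point t ys w) e) ≡ ιℕ (occurrences e)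
      coordinate≡ _ (series i)   = trans (cong ι (lookup-point-series t ys w i)) (cong ιℕ (sym (occurrences-series i)))
      coordinate≡ _ (parallel j) = trans (cong ι (lookup-point-parallel t ys w j)) (cong ιℕ (sym (occurrences-parallel j)))

  feasible⇒latticePoint : ∀ t x → Feasible t x → InDilateLattice (TBasis k (k + m)) t x
  feasible⇒latticePoint zero     x feasible = zero-dilate x feasible
  feasible⇒latticePoint (suc t′) x (ys , w , refl , ys≤t , ∑w≤t , ∑≡kt) =
    Decomposition.latticePoint t′ ys w ys≤t ∑w≤t ∑≡kt

ehrhartValue-enumeration : ∀ k m t → EhrhartValue (TBasis k (k + m)) t (length (FeasiblePoints.enumeration k m t))
ehrhartValue-enumeration k m t = enumeration , enumeration-unique ,
  (λ x → mk⇔ (Sufficiency.feasible⇒latticePoint k m t x ∘ ∈-enumeration⁻ x) (∈-enumeration⁺ x ∘ Necessity.latticePoint⇒feasible k m t)) ,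
  refl
  where open FeasiblePoints k m t

theorem3p1 : (k n : ℕ) → 1 ≤ k → k < n →
    (t : ℕ) → EhrhartValue (TBasis k n) t (Dformula k n t)
theorem3p1 (suc a) n (s≤s z≤n) 1+a<n t =
  subst (λ n → EhrhartValue (TBasis (suc a) n) t (Dformula (suc a) n t)) 1+a+1+b≡n
    (subst (EhrhartValue (TBasis (suc a) (suc a + suc b)) t)
           (trans (length-enumeration a b t) (∑<-binomialProduct a b t))
           (ehrhartValue-enumeration (suc a) (suc b) t))
  where
  b = n ∸ suc (suc a)
  1+a+1+b≡n : suc a + suc b ≡ n
  1+a+1+b≡n = trans (cong suc (ℕP.+-suc a b)) (ℕP.m+[n∸m]≡n 1+a<n)
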